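{- Let $(m_S,m_A)$ be an $f$-pair of statistics. Then for all $n\ge2$, $$\sum_{v\in A_{n+1}}q^{m_A(v)}\prod_{j=1}^{n-1}t_j^{\epsilon_{A,j}(v)}=\sum_{w\in S_n}q^{m_S(w)}\prod_{j=1}^{n-1}(2t_j)^{\epsilon_{S,j}(w)}.$$
   Context: Permutations are multiplied as functions; $s_i=(i,i+1)$. $R^S_j=\{1,s_j,\dots,s_j\cdots s_1\}$; every $w\in S_n$ factors uniquely as $w_1\cdots w_{n-1}$ with $w_j\in R^S_j$; $\epsilon_{S,j}(w)=1$ if $w_j=s_j\cdots s_1$ (i.e. $s_1$ occurs in $w_j$) and $0$ otherwise. In $S_{n+1}$, $a_i=s_1s_{i+1}$ ($1\le i\le n-1$), $R^A_j=\{1,a_j,a_ja_{j-1},\dots,a_j\cdots a_2,a_j\cdots a_2a_1,a_j\cdots a_2a_1^{ -1}\}$ ($R^A_1=\{1,a_1,a_1^{ -1}\}$); every $v\in A_{n+1}$ factors uniquely as $v_1\cdots v_{n-1}$, $v_j\in R^A_j$; $\epsilon_{A,j}(v)=1$ if $a_1$ or $a_1^{ -1}$ occurs in $v_j$ and $0$ otherwise. The map $f:A_{n+1}\to S_n$ is $f(v)=f(v_1)\cdots f(v_{n-1})$ with $f(1)=1$, $f(a_j\cdots a_k)=s_j\cdots s_k$ ($2\le k\le j$), $f(a_j\cdots a_2a_1^{\pm1})=s_j\cdots s_1$. A statistic $m_S$ assigns a nonnegative integer to each permutation of each symmetric group, and $m_A$ to each element of each alternating group; $(m_S,m_A)$ is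 an $f$-pair if $m_A(v)=m_S(f(v))$ for all $n$ and all $v\in A_{n+1}$. -}

module Defs where

open import Data.Nat as ℕ using (ℕ; zero; suc; _∸_; _≡ᵇ_; _<ᵇ_; _≤_)
open import Data.Bool using (Bool; true; false; _∧_; _∨_; not; if_then_else_)
open import Data.List using (List; []; _∷_; _++_; map; foldr; concatMap; zipWith; upTo; filterᵇ; length)
open import Data.List.Membership.Propositional using (_∈_)
open import Relation.Binary.PropositionalEquality using (_≡_)
open import Algebra.Bundles using (CommutativeSemiring)

-- Permutations of {0,…,n-1} in one-line notation: w is the list
-- [w(0), …, w(n-1)].  (Position/value i here is the paper's i+1.)
-- Permutations are multiplied as functions: (x · y)(i) = x(y(i)).

at : List ℕ → ℕ → ℕ
at []       _       = 0
at (x ∷ xs) zero    = x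
at (x ∷ xs) (suc i) = at xs i

idP : ℕ → List ℕ
idP n = upTo n

comp : List ℕ → List ℕ → List ℕ
comp x y = map (at x) y

prodL : ℕ → List (List ℕ) → List ℕ
prodL n = foldr comp (idP n)

eqL : List ℕ → List ℕ → Bool
eqL []       []       = true
eqL (x ∷ xs) (y ∷ ys) = (x ≡ᵇ y) ∧ eqL xs ys
eqL _        _        = false

-- s_i = (i, i+1) in the paper's 1-indexing, i ≥ 1, as an element of S_n
sS : ℕ → ℕ → List ℕ
sS n i = map τ (upTo n)
  where
  τ : ℕ → ℕ
  τ k = if k ≡ᵇ (i ∸ 1) then i else (if k ≡ᵇ i then i ∸ 1 else k)

aA : ℕ → ℕ → List ℕ
aA N i = comp (sS N 1) (sS N (suc i))

aInv1 : ℕ → List ℕ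
aInv1 N = comp (sS N 2) (sS N 1)

desc : ℕ → ℕ → List ℕ
desc j zero    = []
desc j (suc k) = j ∷ desc (j ∸ 1) k

-- Coset representatives.
-- R^S_j = {1, s_j, s_j s_{j-1}, …, s_j ⋯ s_1}; choice k ∈ {0..j}
-- gives s_j ⋯ s_{j-k+1} (k = 0 gives 1).
elemS : ℕ → ℕ → ℕ → List ℕ
elemS n j k = prodL n (map (sS n) (desc j k))

-- R^A_j = {1, a_j, a_j a_{j-1}, …, a_j ⋯ a_2, a_j ⋯ a_2 a_1, a_j ⋯ a_2 a_1⁻¹};
-- choice k ∈ {0..j+1}: k ≤ j gives a_j ⋯ a_{j-k+1}, k = j+1 gives a_j ⋯ a_2 a_1⁻¹.
elemA : ℕ → ℕ → ℕ → List ℕ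
elemA N j k = if k <ᵇ suc j
              then prodL N (map (aA N) (desc j k))
              else prodL N (map (aA N) (desc j (j ∸ 1)) ++ (aInv1 N ∷ []))

-- f on representatives: f(1)=1, f(a_j⋯a_k)=s_j⋯s_k (2≤k≤j),
-- f(a_j⋯a_2a_1^{±1}) = s_j⋯s_1.
fElem : ℕ → ℕ → ℕ → List ℕ
fElem n j k = if k <ᵇ j then elemS n j k else elemS n j j

choices : List ℕ → List (List ℕ)
choices []       = [] ∷ []
choices (b ∷ bs) = concatMap (λ c → map (c ∷_) (choices bs)) (upTo (suc b))

js : ℕ → List ℕ
js n = map suc (upTo (n ∸ 1))

tuplesS : ℕ → List (List ℕ)
tuplesS n = choices (js n)

tuplesA : ℕ → List (List ℕ)
tuplesA n = choices (map suc (js n))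

productS : ℕ → List ℕ → List ℕ
productS n cs = prodL n (zipWith (elemS n) (js n) cs)

productA : ℕ → List ℕ → List ℕ
productA n cs = prodL (suc n) (zipWith (elemA (suc n)) (js n) cs)

findFirst : (List ℕ → Bool) → List (List ℕ) → List ℕ
findFirst p []       = []
findFirst p (x ∷ xs) = if p x then x else findFirst p xs

-- the (unique) factorization of w ∈ S_n, resp. v ∈ A_{n+1},
-- as its list of choices
factorS : ℕ → List ℕ → List ℕ
factorS n w = findFirst (λ cs → eqL (productS n cs) w) (tuplesS n)

factorA : ℕ → List ℕ → List ℕ
factorA n v = findFirst (λ cs → eqL (productA n cs) v) (tuplesA n)

-- ε_{S,j}(w) = 1 iff w_j = s_j ⋯ s_1 (choice j); ε_{A,j}(v) = 1 iff
-- a_1 or a_1⁻¹ occurs in v_j (choice j or j+1).  (j ≥ 1)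
epsS : ℕ → ℕ → List ℕ → ℕ
epsS n j w = if at (factorS n w) (j ∸ 1) ≡ᵇ j then 1 else 0

epsA : ℕ → ℕ → List ℕ → ℕ
epsA n j v = if at (factorA n v) (j ∸ 1) <ᵇ j then 0 else 1

fMap : ℕ → List ℕ → List ℕ
fMap n v = prodL n (zipWith (fElem n) (js n) (factorA n v))

seqs : ℕ → ℕ → List (List ℕ)
seqs n zero    = [] ∷ []
seqs n (suc k) = concatMap (λ x → map (x ∷_) (seqs n k)) (upTo n)

notIn : ℕ → List ℕ → Bool
notIn x []       = true
notIn x (y ∷ ys) = not (x ≡ᵇ y) ∧ notIn x ys

distinct : List ℕ → Bool
distinct []       = true
distinct (x ∷ xs) = notIn x xs ∧ distinct xs

SymGroup : ℕ → List (List ℕ)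
SymGroup n = filterᵇ distinct (seqs n n)

invsWith : ℕ → List ℕ → ℕ
invsWith x []       = 0
invsWith x (y ∷ ys) = (if y <ᵇ x then 1 else 0) ℕ.+ invsWith x ys

inversions : List ℕ → ℕ
inversions []       = 0
inversions (x ∷ xs) = invsWith x xs ℕ.+ inversions xs

isEven : ℕ → Bool
isEven zero          = true
isEven (suc zero)    = false
isEven (suc (suc k)) = isEven k

AltGroup : ℕ → List (List ℕ)
AltGroup n = filterᵇ (λ w → isEven (inversions w)) (SymGroup n)

-- Statistics: m n w is the value on w ∈ S_n (resp. on w ∈ A_n ⊆ S_n).
Statistic : Set
Statistic = ℕ → List ℕ → ℕ

IsFPair : Statistic → Statistic → Set
IsFPair mS mA = ∀ n → 1 ≤ n → ∀ v → v ∈ AltGroup (suc n) →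
                mA (suc n) v ≡ mS n (fMap n v)

-- Generating functions, evaluated in an arbitrary commutative semiring
-- (equality in every commutative semiring = identity of polynomials
-- in ℤ[q, t_1, …, t_{n-1}]).
module GF {c ℓ} (R : CommutativeSemiring c ℓ) where
  open CommutativeSemiring R using (Carrier; _+_; _*_; 0#; 1#)

  pow : Carrier → ℕ → Carrier
  pow x zero    = 1#
  pow x (suc k) = x * pow x k

  sumL : List Carrier → Carrier
  sumL = foldr _+_ 0#

  prodC : List Carrier → Carrier
  prodC = foldr _*_ 1#

  lhsA : Statistic → ℕ → Carrier → (ℕ → Carrier) → Carrier
  lhsA mA n q t = sumL (map (λ v → pow q (mA (suc n) v) *
                      prodC (map (λ j → pow (t j) (epsA n j v)) (js n)))
                    (AltGroup (suc n)))

  rhsS : Statistic → ℕ → Carrier → (ℕ → Carrier) → Carrier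
  rhsS mS n q t = sumL (map (λ w → pow q (mS n w) *
                      prodC (map (λ j → pow ((1# + 1#) * t j) (epsS n j w)) (js n)))
                    (SymGroup n))

-- Both groups are listed by their coset factorisations: every w ∈ S_n is uniquely w_1 ⋯ w_{n-1}
-- with w_j ∈ R^S_j, and every v ∈ A_{n+1} uniquely v_1 ⋯ v_{n-1} with v_j ∈ R^A_j.  Both are
-- instances of one argument: the last factor is determined by the preimage of the largest point,
-- which it has to move into place, and removing it leaves a permutation of one point fewer in the
-- same subgroup (for A_{n+1} because every representative is a word of even length in the s_i).
-- So the left-hand side is a sum over choice tuples (c_1, …, c_{n-1}) with c_j ∈ {0, …, j + 1}.
-- On such tuples f acts coordinatewise by clamping c_j to min(c_j, j), and ε_{A,j}(v) = ε_{S,j}(f v);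
-- hence every tuple of S_n has 2^{#{j : d_j = j}} preimages of equal weight, giving the factors 2 t_j.

module Submission where

open import Defs
open import Data.Nat using (ℕ; zero; suc; _≤_; s≤s; z≤n)
open import Algebra.Bundles using (CommutativeSemiring)

module Permutations where

  open import Data.Nat
  open import Data.Nat.Properties
  open import Data.Bool using (Bool; true; false; if_then_else_; T; not)
  open import Data.Bool.Properties using (not-involutive; T-≡; T-∧; T?)
  open import Data.Empty using (⊥-elim)
  open import Data.List
    using (List; []; _∷_; _++_; _∷ʳ_; map; reverse; upTo; applyUpTo; length; concat; concatMap; zipWith; cartesianProductWith)
  open import Data.List.Properties
    using (unfold-reverse; reverse-involutive; ++-identityʳ; ++-assoc; length-reverse; length-++; length-map; length-upTo;
           concat-++; concat-map-[_]; map-++; map-id; map-∘; map-cong; map-cong-local; map-upTo; upTo-∷ʳ; zipWith-cong; ∷-injective)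
  open import Data.List.Membership.Propositional using (_∈_)
  open import Data.List.Membership.Propositional.Properties
    using (∈-map⁺; ∈-map⁻; ∈-upTo⁺; ∈-upTo⁻; ∈-filter⁺; ∈-filter⁻;
           ∈-cartesianProductWith⁺; ∈-cartesianProductWith⁻)
  open import Data.List.Membership.Propositional.Properties.WithK using (unique∧set⇒bag)
  open import Data.List.Relation.Binary.BagAndSetEquality using (∼bag⇒↭)
  open import Data.List.Relation.Binary.Permutation.Propositional using (_↭_)
  open import Data.List.Relation.Binary.Pointwise as Pointwise using (Pointwise; []; _∷_; Pointwise-length)
  open import Data.List.Relation.Unary.All as All using (All; []; _∷_)
  open import Data.List.Relation.Unary.All.Properties using (++⁺)
  open import Data.List.Relation.Unary.Any using (here; there)
  open import Data.List.Relation.Unary.Unique.Propositional using (Unique; []; _∷_)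
  open import Data.List.Relation.Unary.Unique.Propositional.Properties using (cartesianProductWith⁺; upTo⁺; filter⁺)
  open import Data.Product using (Σ; _×_; _,_; proj₁; proj₂)
  open import Data.Sum using (_⊎_; inj₁; inj₂)
  open import Data.Unit using (⊤; tt)
  open import Function using (_∘′_)
  open import Function.Bundles using (Equivalence; mk⇔)
  open import Relation.Binary.Definitions using (tri<; tri≈; tri>)
  open import Relation.Binary.PropositionalEquality
  open import Relation.Nullary using (¬_; yes; no)
  open import Algebra.Properties.CommutativeSemigroup +-commutativeSemigroup using (x∙yz≈y∙xz)

  ≡ᵇ-refl : ∀ x → (x ≡ᵇ x) ≡ true
  ≡ᵇ-refl zero = refl
  ≡ᵇ-refl (suc x) = ≡ᵇ-refl x

  ≢⇒≡ᵇ-false : ∀ {x y} → x ≢ y → (x ≡ᵇ y) ≡ false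
  ≢⇒≡ᵇ-false {x} {y} x≢y with x ≡ᵇ y in eq
  ... | true = ⊥-elim (x≢y (≡ᵇ⇒≡ x y (subst T (sym eq) _)))
  ... | false = refl

  All-reverse : ∀ {P : ℕ → Set} {w} → All P w → All P (reverse w)
  All-reverse [] = []
  All-reverse {w = i ∷ w} (p ∷ ps) rewrite unfold-reverse i w = ++⁺ (All-reverse ps) (p ∷ [])

  -- Permutations of {0, …, T} as functions

  -- The paper's s_i acts on points i and i + 1; on the 0-based points used here it swaps i ∸ 1 and i,
  -- and transposition 0 is the identity.
  transposition : ℕ → ℕ → ℕ
  transposition i k = if k ≡ᵇ (i ∸ 1) then i else (if k ≡ᵇ i then i ∸ 1 else k)

  transposition-zero : ∀ x → transposition 0 x ≡ x
  transposition-zero zero = refl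
  transposition-zero (suc x) = refl

  transposition-left : ∀ i → transposition (suc i) i ≡ suc i
  transposition-left i rewrite ≡ᵇ-refl i = refl

  transposition-right : ∀ i → transposition (suc i) (suc i) ≡ i
  transposition-right i rewrite ≢⇒≡ᵇ-false (1+n≢n {i}) | ≡ᵇ-refl i = refl

  transposition-other : ∀ i x → x ≢ i → x ≢ suc i → transposition (suc i) x ≡ x
  transposition-other i x x≢i x≢1+i rewrite ≢⇒≡ᵇ-false x≢i | ≢⇒≡ᵇ-false x≢1+i = refl

  transposition-involutive : ∀ i x → transposition i (transposition i x) ≡ x
  transposition-involutive zero x = trans (transposition-zero _) (transposition-zero x)
  transposition-involutive (suc i) x with x ≟ i | x ≟ suc i
  ... | yes refl | _ = trans (cong (transposition (suc i)) (transposition-left i)) (transposition-right i)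
  ... | no _ | yes refl = trans (cong (transposition (suc i)) (transposition-right i)) (transposition-left i)
  ... | no x≢i | no x≢1+i =
    trans (cong (transposition (suc i)) (transposition-other i x x≢i x≢1+i)) (transposition-other i x x≢i x≢1+i)

  transposition-fixes-above : ∀ i x → i < x → transposition i x ≡ x
  transposition-fixes-above zero x _ = transposition-zero x
  transposition-fixes-above (suc i) x i<x =
    transposition-other i x (>⇒≢ (<-trans (n<1+n i) i<x)) (>⇒≢ i<x)

  transposition-≤ : ∀ {i x T} → i ≤ T → x ≤ T → transposition i x ≤ T
  transposition-≤ {zero} {x} _ x≤T rewrite transposition-zero x = x≤T
  transposition-≤ {suc i} {x} i≤T x≤T with x ≟ i | x ≟ suc i
  ... | yes refl | _ rewrite transposition-left i = i≤T
  ... | no _ | yes refl rewrite transposition-right i = ≤-trans (n≤1+n i) i≤T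
  ... | no x≢i | no x≢1+i rewrite transposition-other i x x≢i x≢1+i = x≤T

  ⟦_⟧ : List ℕ → ℕ → ℕ
  ⟦ [] ⟧ x = x
  ⟦ i ∷ w ⟧ x = transposition i (⟦ w ⟧ x)

  ⟦++⟧ : ∀ u v x → ⟦ u ++ v ⟧ x ≡ ⟦ u ⟧ (⟦ v ⟧ x)
  ⟦++⟧ [] v x = refl
  ⟦++⟧ (i ∷ u) v x = cong (transposition i) (⟦++⟧ u v x)

  ⟦reverse⟧∘⟦⟧ : ∀ w x → ⟦ reverse w ⟧ (⟦ w ⟧ x) ≡ x
  ⟦reverse⟧∘⟦⟧ [] x = refl
  ⟦reverse⟧∘⟦⟧ (i ∷ w) x = begin
    ⟦ reverse (i ∷ w) ⟧ (transposition i (⟦ w ⟧ x))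
      ≡⟨ cong (λ u → ⟦ u ⟧ (transposition i (⟦ w ⟧ x))) (unfold-reverse i w) ⟩
    ⟦ reverse w ++ i ∷ [] ⟧ (transposition i (⟦ w ⟧ x))
      ≡⟨ ⟦++⟧ (reverse w) (i ∷ []) _ ⟩
    ⟦ reverse w ⟧ (transposition i (transposition i (⟦ w ⟧ x)))
      ≡⟨ cong ⟦ reverse w ⟧ (transposition-involutive i _) ⟩
    ⟦ reverse w ⟧ (⟦ w ⟧ x)
      ≡⟨ ⟦reverse⟧∘⟦⟧ w x ⟩
    x ∎
    where open ≡-Reasoning

  ⟦⟧∘⟦reverse⟧ : ∀ w x → ⟦ w ⟧ (⟦ reverse w ⟧ x) ≡ x
  ⟦⟧∘⟦reverse⟧ w x =
    subst (λ u → ⟦ u ⟧ (⟦ reverse w ⟧ x) ≡ x) (reverse-involutive w) (⟦reverse⟧∘⟦⟧ (reverse w) x)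

  ⟦⟧-fixes-above : ∀ w x → All (_< x) w → ⟦ w ⟧ x ≡ x
  ⟦⟧-fixes-above [] x _ = refl
  ⟦⟧-fixes-above (i ∷ w) x (i<x ∷ w<x) rewrite ⟦⟧-fixes-above w x w<x = transposition-fixes-above i x i<x

  ⟦⟧-≤ : ∀ {w x T} → All (_≤ T) w → x ≤ T → ⟦ w ⟧ x ≤ T
  ⟦⟧-≤ [] x≤T = x≤T
  ⟦⟧-≤ (i≤T ∷ w≤T) x≤T = transposition-≤ i≤T (⟦⟧-≤ w≤T x≤T)

  record PermutationOn (T : ℕ) (V : ℕ → ℕ) : Set where
    field
      fixes-above : ∀ x → T < x → V x ≡ x
      injective : ∀ x y → V x ≡ V y → x ≡ y
      surjective : ∀ y → y ≤ T → Σ ℕ λ x → x ≤ T × V x ≡ y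

  open PermutationOn public

  PermutationOn-≤ : ∀ {T V} → PermutationOn T V → ∀ {x} → x ≤ T → V x ≤ T
  PermutationOn-≤ {T} {V} π {x} x≤T with V x ≤? T
  ... | yes Vx≤T = Vx≤T
  ... | no Vx≰T = ⊥-elim (<⇒≱ T<Vx (subst (_≤ T) (sym Vx≡x) x≤T))
    where
    T<Vx = ≰⇒> Vx≰T
    Vx≡x = injective π _ _ (fixes-above π (V x) T<Vx)

  ⟦⟧-permutationOn : ∀ {T} w → All (_≤ T) w → PermutationOn T ⟦ w ⟧
  ⟦⟧-permutationOn {T} w w≤T = record
    { fixes-above = λ x T<x → ⟦⟧-fixes-above w x (All.map (λ i≤T → ≤-<-trans i≤T T<x) w≤T)
    ; injective = λ x y eq →
        trans (sym (⟦reverse⟧∘⟦⟧ w x)) (trans (cong ⟦ reverse w ⟧ eq) (⟦reverse⟧∘⟦⟧ w y))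
    ; surjective = λ y y≤T → ⟦ reverse w ⟧ y , ⟦⟧-≤ (All-reverse w≤T) y≤T , ⟦⟧∘⟦reverse⟧ w y
    }

  PermutationOn-∘ : ∀ {T V W} → PermutationOn T V → PermutationOn T W → PermutationOn T (λ x → V (W x))
  PermutationOn-∘ {V = V} π ρ = record
    { fixes-above = λ x T<x → trans (cong V (fixes-above ρ x T<x)) (fixes-above π x T<x)
    ; injective = λ x y eq → injective ρ x y (injective π _ _ eq)
    ; surjective = λ y y≤T →
        let (x₁ , x₁≤T , Vx₁≡y) = surjective π y y≤T
            (x₂ , x₂≤T , Wx₂≡x₁) = surjective ρ x₁ x₁≤T
        in x₂ , x₂≤T , trans (cong V Wx₂≡x₁) Vx₁≡y
    }

  PermutationOn-restrict : ∀ {T U} → PermutationOn (suc T) U → U (suc T) ≡ suc T → PermutationOn T U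
  PermutationOn-restrict {T} {U} π U1+T≡1+T = record
    { fixes-above = fixes
    ; injective = injective π
    ; surjective = onto
    }
    where
    fixes : ∀ x → T < x → U x ≡ x
    fixes x T<x with x ≟ suc T
    ... | yes refl = U1+T≡1+T
    ... | no x≢1+T = fixes-above π x (≤∧≢⇒< T<x (≢-sym x≢1+T))
    onto : ∀ y → y ≤ T → Σ ℕ λ x → x ≤ T × U x ≡ y
    onto y y≤T with surjective π y (m≤n⇒m≤1+n y≤T)
    ... | x , x≤1+T , Ux≡y with x ≟ suc T
    ...   | yes refl = ⊥-elim (<⇒≱ (n<1+n T) (subst (_≤ T) (trans (sym Ux≡y) U1+T≡1+T) y≤T))
    ...   | no x≢1+T = x , ≤-pred (≤∧≢⇒< x≤1+T x≢1+T) , Ux≡y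

  PermutationOn-extend : ∀ {T U} → PermutationOn T U → PermutationOn (suc T) U
  PermutationOn-extend {T} {U} π = record
    { fixes-above = λ x 1+T<x → fixes-above π x (<-trans (n<1+n T) 1+T<x)
    ; injective = injective π
    ; surjective = onto
    }
    where
    onto : ∀ y → y ≤ suc T → Σ ℕ λ x → x ≤ suc T × U x ≡ y
    onto y y≤1+T with y ≟ suc T
    ... | yes refl = suc T , ≤-refl , fixes-above π (suc T) (n<1+n T)
    ... | no y≢1+T =
      let (x , x≤T , Ux≡y) = surjective π y (≤-pred (≤∧≢⇒< y≤1+T y≢1+T)) in x , m≤n⇒m≤1+n x≤T , Ux≡y

  -- Factorisation along a transversal

  levels : ℕ → List ℕ
  levels m = map suc (upTo m)

  levels-suc : ∀ m → levels (suc m) ≡ levels m ∷ʳ suc m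
  levels-suc m = trans (cong (map suc) (sym (upTo-∷ʳ m))) (map-++ suc (upTo m) (m ∷ []))

  length-levels : ∀ m → length (levels m) ≡ m
  length-levels m = trans (length-map suc (upTo m)) (length-upTo m)

  All-levels : ∀ m → All (λ j → 1 ≤ j × j ≤ m) (levels m)
  All-levels zero = []
  All-levels (suc m) rewrite levels-suc m =
    ++⁺ (All.map (λ (1≤j , j≤m) → 1≤j , m≤n⇒m≤1+n j≤m) (All-levels m)) ((s≤s z≤n , ≤-refl) ∷ [])

  Pointwise-∷ʳ⁻ : ∀ {R : ℕ → ℕ → Set} {c} ks k → Pointwise R c (ks ∷ʳ k) →
                  Σ (List ℕ) λ c′ → Σ ℕ λ x → c ≡ c′ ∷ʳ x × Pointwise R c′ ks × R x k
  Pointwise-∷ʳ⁻ [] k (x≤k ∷ []) = [] , _ , refl , [] , x≤k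
  Pointwise-∷ʳ⁻ (_ ∷ ks) k (y≤k′ ∷ c≤ks) with Pointwise-∷ʳ⁻ ks k c≤ks
  ... | c′ , x , refl , c′≤ks , x≤k = _ ∷ c′ , x , refl , y≤k′ ∷ c′≤ks , x≤k

  Pointwise-∷ʳ⁺ : ∀ {R : ℕ → ℕ → Set} {c ks x k} → Pointwise R c ks → R x k → Pointwise R (c ∷ʳ x) (ks ∷ʳ k)
  Pointwise-∷ʳ⁺ [] x≤k = x≤k ∷ []
  Pointwise-∷ʳ⁺ (y≤k′ ∷ c≤ks) x≤k = y≤k′ ∷ Pointwise-∷ʳ⁺ c≤ks x≤k

  concat-zipWith-∷ʳ : ∀ (f : ℕ → ℕ → List ℕ) bl c j x → length bl ≡ length c →
                      concat (zipWith f (bl ∷ʳ j) (c ∷ʳ x)) ≡ concat (zipWith f bl c) ++ f j x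
  concat-zipWith-∷ʳ f [] [] j x _ = ++-identityʳ (f j x)
  concat-zipWith-∷ʳ f (j′ ∷ bl) (x′ ∷ c) j x eq =
    trans (cong (f j′ x′ ++_) (concat-zipWith-∷ʳ f bl c j x (suc-injective eq))) (sym (++-assoc (f j′ x′) _ _))

  -- Representatives of the cosets at level j are indexed by k ∈ {0, …, bound j}; on {0, …, δ + j}
  -- the representative k is the unique one sending origin j k to the top point δ + j.
  record Transversal (δ : ℕ) : Set where
    field
      bound : ℕ → ℕ
      rep : ℕ → ℕ → List ℕ
      origin : ℕ → ℕ → ℕ
      rep-≤ : ∀ {j k} → 1 ≤ j → k ≤ bound j → All (_≤ δ + j) (rep j k)
      rep-origin : ∀ {j k} → 1 ≤ j → k ≤ bound j → ⟦ rep j k ⟧ (origin j k) ≡ δ + j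
      origin-injective : ∀ {j k k′} → k ≤ bound j → k′ ≤ bound j → origin j k ≡ origin j k′ → k ≡ k′
      origin-surjective : ∀ {j p} → 1 ≤ j → p ≤ δ + j → Σ ℕ λ k → k ≤ bound j × origin j k ≡ p

  -- A family of subgroups G_T of the permutations of {0, …, T}, compatible with the transversal:
  -- G_δ is trivial and the representatives at level j lie in G_{δ+j}.
  record Compatible {δ} (τ : Transversal δ) : Set₁ where
    open Transversal τ
    field
      Member : ℕ → (ℕ → ℕ) → Set
      Member-cong : ∀ {T V V′} → (∀ x → V x ≡ V′ x) → Member T V → Member T V′
      Member-trivial : ∀ {V} → PermutationOn δ V → Member δ V → ∀ x → V x ≡ x
      Member-id : Member δ (λ x → x)
      Member-∘rep : ∀ {j k V} → 1 ≤ j → k ≤ bound j → PermutationOn (δ + j) V → Member (δ + j) V →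
                    Member (δ + j) (λ x → V (⟦ rep j k ⟧ x))
      Member-∘rep⁻¹ : ∀ {j k V} → 1 ≤ j → k ≤ bound j → PermutationOn (δ + j) V → Member (δ + j) V →
                      Member (δ + j) (λ x → V (⟦ reverse (rep j k) ⟧ x))
      Member-restrict : ∀ {m U} → PermutationOn (δ + suc m) U → U (δ + suc m) ≡ δ + suc m →
                        Member (δ + suc m) U → Member (δ + m) U
      Member-extend : ∀ {m U} → PermutationOn (δ + m) U → Member (δ + m) U → Member (δ + suc m) U

  module Factorisation {δ} (τ : Transversal δ) (G : Compatible τ) where
    open Transversal τ
    open Compatible G

    private
      extend : ∀ {m V} → PermutationOn (δ + m) V → PermutationOn (δ + suc m) V
      extend {m} {V} π = subst (λ T → PermutationOn T V) (sym (+-suc δ m)) (PermutationOn-extend π)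

      restrict : ∀ {m V} → PermutationOn (δ + suc m) V → V (δ + suc m) ≡ δ + suc m → PermutationOn (δ + m) V
      restrict {m} {V} π V-top = PermutationOn-restrict (subst (λ T → PermutationOn T V) (+-suc δ m) π)
                                                         (subst (λ T → V T ≡ T) (+-suc δ m) V-top)

    Choice : ℕ → List ℕ → Set
    Choice m c = Pointwise _≤_ c (map bound (levels m))

    product : ℕ → List ℕ → ℕ → ℕ
    product m c = ⟦ concat (zipWith rep (levels m) c) ⟧

    Choice-∷ʳ⁻ : ∀ {m c} → Choice (suc m) c →
                 Σ (List ℕ) λ c′ → Σ ℕ λ x → c ≡ c′ ∷ʳ x × Choice m c′ × x ≤ bound (suc m)
    Choice-∷ʳ⁻ {m} {c} c≤ = Pointwise-∷ʳ⁻ (map bound (levels m)) (bound (suc m))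
      (subst (Pointwise _≤_ c) (trans (cong (map bound) (levels-suc m)) (map-++ bound (levels m) _)) c≤)

    Choice-∷ʳ⁺ : ∀ {m c x} → Choice m c → x ≤ bound (suc m) → Choice (suc m) (c ∷ʳ x)
    Choice-∷ʳ⁺ {m} {c} {x} c≤ x≤ =
      subst (Pointwise _≤_ (c ∷ʳ x)) (sym (trans (cong (map bound) (levels-suc m)) (map-++ bound (levels m) _)))
        (Pointwise-∷ʳ⁺ c≤ x≤)

    product-∷ʳ : ∀ {m c} x → Choice m c → ∀ y → product (suc m) (c ∷ʳ x) y ≡ product m c (⟦ rep (suc m) x ⟧ y)
    product-∷ʳ {m} {c} x c≤ y rewrite levels-suc m
      | concat-zipWith-∷ʳ rep (levels m) c (suc m) x
          (sym (trans (Pointwise-length c≤) (length-map bound (levels m)))) =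
      ⟦++⟧ (concat (zipWith rep (levels m) c)) (rep (suc m) x) y

    product-permutationOn : ∀ {m c} → Choice m c → PermutationOn (δ + m) (product m c)
    product-permutationOn {m} {c} c≤ = ⟦⟧-permutationOn _ (go (levels m) c (All-levels m) c≤)
      where
      go : ∀ bl c → All (λ j → 1 ≤ j × j ≤ m) bl → Pointwise _≤_ c (map bound bl) →
           All (_≤ δ + m) (concat (zipWith rep bl c))
      go [] [] [] [] = []
      go (j ∷ bl) (k ∷ c) ((1≤j , j≤m) ∷ bl≤m) (k≤ ∷ c≤) =
        ++⁺ (All.map (λ i≤ → ≤-trans i≤ (+-monoʳ-≤ δ j≤m)) (rep-≤ 1≤j k≤)) (go bl c bl≤m c≤)

    product-origin : ∀ {m c x} → Choice m c → x ≤ bound (suc m) →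
                     product (suc m) (c ∷ʳ x) (origin (suc m) x) ≡ δ + suc m
    product-origin {m} {c} {x} c≤ x≤ = begin
      product (suc m) (c ∷ʳ x) (origin (suc m) x)     ≡⟨ product-∷ʳ x c≤ _ ⟩
      product m c (⟦ rep (suc m) x ⟧ (origin (suc m) x)) ≡⟨ cong (product m c) (rep-origin (s≤s z≤n) x≤) ⟩
      product m c (δ + suc m)                          ≡⟨ fixes-above (product-permutationOn c≤) _ (+-monoʳ-< δ (n<1+n m)) ⟩
      δ + suc m ∎
      where open ≡-Reasoning

    product-injective : ∀ {m c d} → Choice m c → Choice m d → (∀ y → product m c y ≡ product m d y) → c ≡ d
    product-injective {zero} [] [] _ = refl
    product-injective {suc m} c≤ d≤ c≗d with Choice-∷ʳ⁻ c≤ | Choice-∷ʳ⁻ d≤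
    ... | c′ , x , refl , c′≤ , x≤ | d′ , y , refl , d′≤ , y≤ = cong₂ _∷ʳ_ c′≡d′ x≡y
      where
      x≡y : x ≡ y
      x≡y = origin-injective x≤ y≤ (injective (product-permutationOn (Choice-∷ʳ⁺ c′≤ x≤)) _ _
              (trans (product-origin c′≤ x≤) (sym (trans (c≗d _) (product-origin d′≤ y≤)))))
      c′≡d′ : c′ ≡ d′
      c′≡d′ = product-injective c′≤ d′≤ λ z →
        let z′ = ⟦ reverse (rep (suc m) x) ⟧ z in
        begin
          product m c′ z                      ≡⟨ cong (product m c′) (sym (⟦⟧∘⟦reverse⟧ (rep (suc m) x) z)) ⟩
          product m c′ (⟦ rep (suc m) x ⟧ z′) ≡⟨ sym (product-∷ʳ x c′≤ z′) ⟩
          product (suc m) (c′ ∷ʳ x) z′         ≡⟨ c≗d z′ ⟩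
          product (suc m) (d′ ∷ʳ y) z′         ≡⟨ product-∷ʳ y d′≤ z′ ⟩
          product m d′ (⟦ rep (suc m) y ⟧ z′) ≡⟨ cong (λ k → product m d′ (⟦ rep (suc m) k ⟧ z′)) (sym x≡y) ⟩
          product m d′ (⟦ rep (suc m) x ⟧ z′) ≡⟨ cong (product m d′) (⟦⟧∘⟦reverse⟧ (rep (suc m) x) z) ⟩
          product m d′ z ∎
        where open ≡-Reasoning

    product-member : ∀ {m c} → Choice m c → Member (δ + m) (product m c)
    product-member {zero} [] = subst (λ T → Member T (λ x → x)) (sym (+-identityʳ δ)) Member-id
    product-member {suc m} c≤ with Choice-∷ʳ⁻ c≤
    ... | c′ , x , refl , c′≤ , x≤ =
      Member-cong (λ y → sym (product-∷ʳ x c′≤ y))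
        (Member-∘rep (s≤s z≤n) x≤ (extend π) (Member-extend π (product-member c′≤)))
      where π = product-permutationOn c′≤

    -- Peel off the representative that moves the preimage of the top point into place.
    product-surjective : ∀ {m V} → PermutationOn (δ + m) V → Member (δ + m) V →
                         Σ (List ℕ) λ c → Choice m c × (∀ y → product m c y ≡ V y)
    product-surjective {zero} {V} π V∈G = [] , [] , λ y → sym (Member-trivial
      (subst (λ T → PermutationOn T V) (+-identityʳ δ) π) (subst (λ T → Member T V) (+-identityʳ δ) V∈G) y)
    product-surjective {suc m} {V} π V∈G with surjective π (δ + suc m) ≤-refl
    ... | p , p≤ , Vp≡top with origin-surjective (s≤s z≤n) p≤
    ... | k , k≤ , origin≡p with product-surjective (restrict πU U-top) (Member-restrict πU U-top U∈G)
      where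
      w = rep (suc m) k
      U : ℕ → ℕ
      U y = V (⟦ reverse w ⟧ y)
      πU : PermutationOn (δ + suc m) U
      πU = PermutationOn-∘ π (⟦⟧-permutationOn (reverse w) (All-reverse (rep-≤ (s≤s z≤n) k≤)))
      U∈G : Member (δ + suc m) U
      U∈G = Member-∘rep⁻¹ (s≤s z≤n) k≤ π V∈G
      U-top : U (δ + suc m) ≡ δ + suc m
      U-top = begin
        V (⟦ reverse w ⟧ (δ + suc m))
          ≡⟨ cong (λ z → V (⟦ reverse w ⟧ z)) (sym (rep-origin (s≤s z≤n) k≤)) ⟩
        V (⟦ reverse w ⟧ (⟦ w ⟧ (origin (suc m) k)))
          ≡⟨ cong V (⟦reverse⟧∘⟦⟧ w _) ⟩
        V (origin (suc m) k)
          ≡⟨ cong V origin≡p ⟩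
        V p
          ≡⟨ Vp≡top ⟩
        δ + suc m ∎
        where open ≡-Reasoning
    ... | c , c≤ , c≗U = c ∷ʳ k , Choice-∷ʳ⁺ c≤ k≤ , λ y →
      trans (product-∷ʳ k c≤ y) (trans (c≗U _) (cong V (⟦reverse⟧∘⟦⟧ (rep (suc m) k) y)))

  -- One-line notation and parity

  <ᵇ-true : ∀ {m n} → m < n → (m <ᵇ n) ≡ true
  <ᵇ-true {m} {n} m<n with m <ᵇ n | <⇒<ᵇ m<n
  ... | true | _ = refl

  <ᵇ-false : ∀ {m n} → ¬ m < n → (m <ᵇ n) ≡ false
  <ᵇ-false {m} {n} m≮n with m <ᵇ n in eq
  ... | true = ⊥-elim (m≮n (<ᵇ⇒< m n (subst T (sym eq) _)))
  ... | false = refl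

  at-map : ∀ (f : ℕ → ℕ) xs {i} → i < length xs → at (map f xs) i ≡ f (at xs i)
  at-map f (x ∷ xs) {zero} _ = refl
  at-map f (x ∷ xs) {suc i} (s≤s i<) = at-map f xs i<

  at∈ : ∀ xs {i} → i < length xs → at xs i ∈ xs
  at∈ (x ∷ xs) {zero} _ = here refl
  at∈ (x ∷ xs) {suc i} (s≤s i<) = there (at∈ xs i<)

  at-applyUpTo : ∀ (f : ℕ → ℕ) {n i} → i < n → at (applyUpTo f n) i ≡ f i
  at-applyUpTo f {suc n} {zero} _ = refl
  at-applyUpTo f {suc n} {suc i} (s≤s i<n) = at-applyUpTo (λ x → f (suc x)) i<n

  at-upTo : ∀ {n i} → i < n → at (upTo n) i ≡ i
  at-upTo = at-applyUpTo (λ x → x)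

  at-extensionality : ∀ (xs ys : List ℕ) → length xs ≡ length ys →
                      (∀ i → i < length xs → at xs i ≡ at ys i) → xs ≡ ys
  at-extensionality [] [] _ _ = refl
  at-extensionality (x ∷ xs) (y ∷ ys) eq at≗ =
    cong₂ _∷_ (at≗ 0 (s≤s z≤n)) (at-extensionality xs ys (suc-injective eq) (λ i i< → at≗ (suc i) (s≤s i<)))

  oneLine : ℕ → (ℕ → ℕ) → List ℕ
  oneLine N V = map V (upTo N)

  length-oneLine : ∀ N V → length (oneLine N V) ≡ N
  length-oneLine N V = trans (length-map V (upTo N)) (length-upTo N)

  at-oneLine : ∀ {N} V {i} → i < N → at (oneLine N V) i ≡ V i
  at-oneLine {N} V i<N = trans (at-map V (upTo N) (subst (_ <_) (sym (length-upTo N)) i<N)) (cong V (at-upTo i<N))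

  oneLine-cong : ∀ N {V V′} → (∀ x → V x ≡ V′ x) → oneLine N V ≡ oneLine N V′
  oneLine-cong N V≗V′ = map-cong V≗V′ (upTo N)

  oneLine-suc : ∀ N V → oneLine (suc N) V ≡ oneLine N V ++ V N ∷ []
  oneLine-suc N V = trans (cong (map V) (sym (upTo-∷ʳ N))) (map-++ V (upTo N) (N ∷ []))

  swapAt : ℕ → List ℕ → List ℕ
  swapAt zero (a ∷ b ∷ r) = b ∷ a ∷ r
  swapAt (suc k) (a ∷ r) = a ∷ swapAt k r
  swapAt _ l = l

  length-swapAt : ∀ k xs → length (swapAt k xs) ≡ length xs
  length-swapAt zero [] = refl
  length-swapAt zero (a ∷ []) = refl
  length-swapAt zero (a ∷ b ∷ r) = refl
  length-swapAt (suc k) [] = refl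
  length-swapAt (suc k) (a ∷ r) = cong suc (length-swapAt k r)

  transposition-suc : ∀ k x → transposition (suc (suc k)) (suc x) ≡ suc (transposition (suc k) x)
  transposition-suc k x with x ≡ᵇ k | x ≡ᵇ suc k
  ... | true | _ = refl
  ... | false | true = refl
  ... | false | false = refl

  at-swapAt : ∀ k xs i → suc k < length xs → at (swapAt k xs) i ≡ at xs (transposition (suc k) i)
  at-swapAt zero (a ∷ b ∷ r) zero _ = refl
  at-swapAt zero (a ∷ b ∷ r) (suc zero) _ = refl
  at-swapAt zero (a ∷ b ∷ r) (suc (suc i)) _ = refl
  at-swapAt zero (a ∷ []) i (s≤s ())
  at-swapAt (suc k) (a ∷ r) zero _ = refl
  at-swapAt (suc k) (a ∷ r) (suc i) (s≤s k<) rewrite transposition-suc k i = at-swapAt k r i k<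

  swapAt-oneLine : ∀ {T V k} → suc k ≤ T →
                   oneLine (suc T) (λ x → V (transposition (suc k) x)) ≡ swapAt k (oneLine (suc T) V)
  swapAt-oneLine {T} {V} {k} k<T = at-extensionality _ _
    (trans (length-oneLine (suc T) _) (sym (trans (length-swapAt k _) (length-oneLine (suc T) V))))
    λ i i< → let i<1+T = subst (i <_) (length-oneLine (suc T) _) i< in
      begin
        at (oneLine (suc T) (λ x → V (transposition (suc k) x))) i
          ≡⟨ at-oneLine _ i<1+T ⟩
        V (transposition (suc k) i)
          ≡⟨ sym (at-oneLine V (s≤s (transposition-≤ k<T (≤-pred i<1+T)))) ⟩
        at (oneLine (suc T) V) (transposition (suc k) i)
          ≡⟨ sym (at-swapAt k _ i k+1<) ⟩
        at (swapAt k (oneLine (suc T) V)) i ∎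
    where
    open ≡-Reasoning
    k+1< : suc k < length (oneLine (suc T) V)
    k+1< = subst (suc k <_) (sym (length-oneLine (suc T) V)) (s≤s k<T)

  invsWith-swapAt : ∀ a k xs → invsWith a (swapAt k xs) ≡ invsWith a xs
  invsWith-swapAt a zero [] = refl
  invsWith-swapAt a zero (x ∷ []) = refl
  invsWith-swapAt a zero (x ∷ y ∷ r) = x∙yz≈y∙xz (if y <ᵇ a then 1 else 0) (if x <ᵇ a then 1 else 0) _
  invsWith-swapAt a (suc k) [] = refl
  invsWith-swapAt a (suc k) (x ∷ r) = cong ((if x <ᵇ a then 1 else 0) +_) (invsWith-swapAt a k r)

  Adjacent : ℕ → ℕ → Set
  Adjacent a b = suc a ≡ b ⊎ suc b ≡ a

  inversions-swapAt : ∀ k xs → suc k < length xs → at xs k ≢ at xs (suc k) →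
                      Adjacent (inversions (swapAt k xs)) (inversions xs)
  inversions-swapAt zero (a ∷ b ∷ r) _ a≢b with <-cmp a b
  ... | tri< a<b _ _ rewrite <ᵇ-true a<b | <ᵇ-false (<⇒≯ a<b) =
    inj₂ (cong suc (x∙yz≈y∙xz (invsWith a r) (invsWith b r) (inversions r)))
  ... | tri≈ _ a≡b _ = ⊥-elim (a≢b a≡b)
  ... | tri> _ _ b<a rewrite <ᵇ-true b<a | <ᵇ-false (<⇒≯ b<a) =
    inj₁ (cong suc (x∙yz≈y∙xz (invsWith b r) (invsWith a r) (inversions r)))
  inversions-swapAt zero (a ∷ []) (s≤s ()) _
  inversions-swapAt (suc k) (a ∷ r) (s≤s k<) ≢ rewrite invsWith-swapAt a k r with inversions-swapAt k r k< ≢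
  ... | inj₁ eq = inj₁ (trans (sym (+-suc (invsWith a r) _)) (cong (invsWith a r +_) eq))
  ... | inj₂ eq = inj₂ (trans (sym (+-suc (invsWith a r) _)) (cong (invsWith a r +_) eq))

  isEven-suc : ∀ n → isEven (suc n) ≡ not (isEven n)
  isEven-suc zero = refl
  isEven-suc (suc n) = trans (sym (not-involutive (isEven n))) (cong not (sym (isEven-suc n)))

  isEven-Adjacent : ∀ {a b} → Adjacent a b → isEven a ≡ not (isEven b)
  isEven-Adjacent {a} (inj₁ refl) = trans (sym (not-involutive (isEven a))) (cong not (sym (isEven-suc a)))
  isEven-Adjacent {b = b} (inj₂ refl) = isEven-suc b

  -- true for the even permutations of {0, …, T}
  sign : ℕ → (ℕ → ℕ) → Bool
  sign T V = isEven (inversions (oneLine (suc T) V))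

  sign-cong : ∀ T {V V′} → (∀ x → V x ≡ V′ x) → sign T V ≡ sign T V′
  sign-cong T V≗V′ = cong (λ l → isEven (inversions l)) (oneLine-cong (suc T) V≗V′)

  sign-∘transposition : ∀ {T V k} → suc k ≤ T → PermutationOn T V →
                        sign T (λ x → V (transposition (suc k) x)) ≡ not (sign T V)
  sign-∘transposition {T} {V} {k} k<T π =
    isEven-Adjacent (subst (λ l → Adjacent (inversions l) (inversions xs)) (sym (swapAt-oneLine k<T))
      (inversions-swapAt k xs (subst (suc k <_) (sym (length-oneLine (suc T) V)) (s≤s k<T)) Vk≢V1+k))
    where
    xs = oneLine (suc T) V
    Vk≢V1+k : at xs k ≢ at xs (suc k)
    Vk≢V1+k eq = 1+n≢n (sym (injective π k (suc k)
      (trans (sym (at-oneLine V (m≤n⇒m≤1+n k<T))) (trans eq (at-oneLine V (s≤s k<T))))))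

  data Even : ℕ → Set where
    even-zero : Even 0
    even-2+ : ∀ {n} → Even n → Even (suc (suc n))

  Even-+ : ∀ {a b} → Even a → Even b → Even (a + b)
  Even-+ even-zero b = b
  Even-+ (even-2+ a) b = even-2+ (Even-+ a b)

  Letter : ℕ → ℕ → Set
  Letter T i = 1 ≤ i × i ≤ T

  sign-∘⟦⟧ : ∀ {T V} w → Even (length w) → All (Letter T) w → PermutationOn T V →
             sign T (λ x → V (⟦ w ⟧ x)) ≡ sign T V
  sign-∘⟦⟧ [] even-zero [] π = refl
  sign-∘⟦⟧ {T} {V} (suc i ∷ suc j ∷ w) (even-2+ even) ((_ , i≤T) ∷ (_ , j≤T) ∷ w≤T) π = begin
    sign T (λ x → V (transposition (suc i) (transposition (suc j) (⟦ w ⟧ x))))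
      ≡⟨ sign-∘⟦⟧ w even w≤T (PermutationOn-∘ π (⟦⟧-permutationOn (suc i ∷ suc j ∷ []) (i≤T ∷ j≤T ∷ []))) ⟩
    sign T (λ x → V (transposition (suc i) (transposition (suc j) x)))
      ≡⟨ sign-∘transposition j≤T (PermutationOn-∘ π (⟦⟧-permutationOn (suc i ∷ []) (i≤T ∷ []))) ⟩
    not (sign T (λ x → V (transposition (suc i) x)))
      ≡⟨ cong not (sign-∘transposition i≤T π) ⟩
    not (not (sign T V))
      ≡⟨ not-involutive _ ⟩
    sign T V ∎
    where open ≡-Reasoning

  invsWith-∷ʳ : ∀ x xs {y} → ¬ y < x → invsWith x (xs ++ y ∷ []) ≡ invsWith x xs
  invsWith-∷ʳ x [] y≮x rewrite <ᵇ-false y≮x = refl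
  invsWith-∷ʳ x (z ∷ xs) y≮x = cong ((if z <ᵇ x then 1 else 0) +_) (invsWith-∷ʳ x xs y≮x)

  inversions-∷ʳ : ∀ xs {y} → All (_< y) xs → inversions (xs ++ y ∷ []) ≡ inversions xs
  inversions-∷ʳ [] _ = refl
  inversions-∷ʳ (x ∷ xs) (x<y ∷ xs<y) = cong₂ _+_ (invsWith-∷ʳ x xs (<⇒≯ x<y)) (inversions-∷ʳ xs xs<y)

  sign-extend : ∀ {T U} → PermutationOn T U → U (suc T) ≡ suc T → sign (suc T) U ≡ sign T U
  sign-extend {T} {U} π U1+T≡1+T = cong isEven (begin
    inversions (oneLine (suc (suc T)) U)           ≡⟨ cong inversions (oneLine-suc (suc T) U) ⟩
    inversions (oneLine (suc T) U ++ U (suc T) ∷ []) ≡⟨ cong (λ y → inversions (oneLine (suc T) U ++ y ∷ [])) U1+T≡1+T ⟩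
    inversions (oneLine (suc T) U ++ suc T ∷ [])   ≡⟨ inversions-∷ʳ (oneLine (suc T) U) (All.tabulate below) ⟩
    inversions (oneLine (suc T) U) ∎)
    where
    open ≡-Reasoning
    below : ∀ {y} → y ∈ oneLine (suc T) U → y < suc T
    below y∈ with ∈-map⁻ U y∈
    ... | x , x∈ , refl = s≤s (PermutationOn-≤ π (≤-pred (∈-upTo⁻ x∈)))

  even-arrangement-of-two : ∀ {a b} → a ≤ 1 → b ≤ 1 → a ≢ b → isEven (inversions (a ∷ b ∷ [])) ≡ true →
                            a ≡ 0 × b ≡ 1
  even-arrangement-of-two {zero} {zero} _ _ a≢b _ = ⊥-elim (a≢b refl)
  even-arrangement-of-two {zero} {suc zero} _ _ _ _ = refl , refl
  even-arrangement-of-two {suc zero} {zero} _ _ _ ()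
  even-arrangement-of-two {suc zero} {suc zero} _ _ a≢b _ = ⊥-elim (a≢b refl)
  even-arrangement-of-two {zero} {suc (suc _)} _ (s≤s ()) _ _
  even-arrangement-of-two {suc zero} {suc (suc _)} _ (s≤s ()) _ _
  even-arrangement-of-two {suc (suc _)} (s≤s ()) _ _ _

  sign-trivial : ∀ {V} → PermutationOn 1 V → sign 1 V ≡ true → ∀ x → V x ≡ x
  sign-trivial {V} π even = pointwise
    where
    V01 = even-arrangement-of-two (PermutationOn-≤ π z≤n) (PermutationOn-≤ π ≤-refl)
            (λ eq → 0≢1+n (injective π 0 1 eq)) even
    pointwise : ∀ x → V x ≡ x
    pointwise zero = proj₁ V01
    pointwise (suc zero) = proj₂ V01
    pointwise (suc (suc x)) = fixes-above π (suc (suc x)) (s≤s (s≤s z≤n))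

  oneLine-injective : ∀ {T V V′} → PermutationOn T V → PermutationOn T V′ →
                      oneLine (suc T) V ≡ oneLine (suc T) V′ → ∀ x → V x ≡ V′ x
  oneLine-injective {T} {V} {V′} π π′ eq x with x ≤? T
  ... | yes x≤T = trans (sym (at-oneLine V (s≤s x≤T))) (trans (cong (λ l → at l x) eq) (at-oneLine V′ (s≤s x≤T)))
  ... | no x≰T = trans (fixes-above π x (≰⇒> x≰T)) (sym (fixes-above π′ x (≰⇒> x≰T)))

  comp-oneLine : ∀ {N} f {g} → (∀ {x} → x < N → g x < N) → comp (oneLine N f) (oneLine N g) ≡ oneLine N (λ x → f (g x))
  comp-oneLine {N} f {g} g< = trans (sym (map-∘ (upTo N)))
    (map-cong-local (All.tabulate λ x∈ → at-oneLine f (g< (∈-upTo⁻ x∈))))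

  Spells : ℕ → List ℕ → List ℕ → Set
  Spells T g w = All (_≤ T) w × g ≡ oneLine (suc T) ⟦ w ⟧

  -- sS is, definitionally, the one-line notation of a transposition.
  spells-transposition : ∀ {T i} → i ≤ T → Spells T (sS (suc T) i) (i ∷ [])
  spells-transposition i≤T = i≤T ∷ [] , refl

  comp-spells : ∀ {T g h u v} → Spells T g u → Spells T h v → Spells T (comp g h) (u ++ v)
  comp-spells {T} {u = u} {v} (u≤T , refl) (v≤T , refl) = ++⁺ u≤T v≤T , (begin
    comp (oneLine (suc T) ⟦ u ⟧) (oneLine (suc T) ⟦ v ⟧)
      ≡⟨ comp-oneLine ⟦ u ⟧ (λ x< → s≤s (⟦⟧-≤ v≤T (≤-pred x<))) ⟩
    oneLine (suc T) (λ x → ⟦ u ⟧ (⟦ v ⟧ x))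
      ≡⟨ oneLine-cong (suc T) (λ x → sym (⟦++⟧ u v x)) ⟩
    oneLine (suc T) ⟦ u ++ v ⟧ ∎)
    where open ≡-Reasoning

  prodL-spells : ∀ {T gs ws} → Pointwise (Spells T) gs ws → Spells T (prodL (suc T) gs) (concat ws)
  prodL-spells {T} [] = [] , sym (map-id (upTo (suc T)))
  prodL-spells (g-spells ∷ gs-spell) = comp-spells g-spells (prodL-spells gs-spell)

  prefixing≡cartesianProduct : ∀ xs (S : List (List ℕ)) →
    concatMap (λ x → map (x ∷_) S) xs ≡ cartesianProductWith _∷_ xs S
  prefixing≡cartesianProduct [] S = refl
  prefixing≡cartesianProduct (x ∷ xs) S = cong (map (x ∷_) S ++_) (prefixing≡cartesianProduct xs S)

  ∈-choices⁺ : ∀ {ks c} → Pointwise _≤_ c ks → c ∈ choices ks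
  ∈-choices⁺ [] = here refl
  ∈-choices⁺ {k ∷ ks} (x≤k ∷ c≤ks) rewrite prefixing≡cartesianProduct (upTo (suc k)) (choices ks) =
    ∈-cartesianProductWith⁺ _∷_ (∈-upTo⁺ (s≤s x≤k)) (∈-choices⁺ c≤ks)

  ∈-choices⁻ : ∀ ks {c} → c ∈ choices ks → Pointwise _≤_ c ks
  ∈-choices⁻ [] (here refl) = []
  ∈-choices⁻ (k ∷ ks) c∈ rewrite prefixing≡cartesianProduct (upTo (suc k)) (choices ks)
    with ∈-cartesianProductWith⁻ _∷_ (upTo (suc k)) (choices ks) c∈
  ... | x , c′ , x∈ , c′∈ , refl = ≤-pred (∈-upTo⁻ x∈) ∷ ∈-choices⁻ ks c′∈

  choices-unique : ∀ ks → Unique (choices ks)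
  choices-unique [] = [] ∷ []
  choices-unique (k ∷ ks) rewrite prefixing≡cartesianProduct (upTo (suc k)) (choices ks) =
    cartesianProductWith⁺ _∷_ ∷-injective (upTo⁺ (suc k)) (choices-unique ks)

  ∈-seqs⁺ : ∀ {n k w} → length w ≡ k → All (_< n) w → w ∈ seqs n k
  ∈-seqs⁺ {k = zero} {[]} refl [] = here refl
  ∈-seqs⁺ {n} {suc k} {x ∷ w} eq (x<n ∷ w<n) rewrite prefixing≡cartesianProduct (upTo n) (seqs n k) =
    ∈-cartesianProductWith⁺ _∷_ (∈-upTo⁺ x<n) (∈-seqs⁺ (suc-injective eq) w<n)

  ∈-seqs⁻ : ∀ n k {w} → w ∈ seqs n k → length w ≡ k × All (_< n) w
  ∈-seqs⁻ n zero (here refl) = refl , []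
  ∈-seqs⁻ n (suc k) w∈ rewrite prefixing≡cartesianProduct (upTo n) (seqs n k)
    with ∈-cartesianProductWith⁻ _∷_ (upTo n) (seqs n k) w∈
  ... | x , w′ , x∈ , w′∈ , refl with ∈-seqs⁻ n k w′∈
  ... | eq , w′<n = cong suc eq , ∈-upTo⁻ x∈ ∷ w′<n

  seqs-unique : ∀ n k → Unique (seqs n k)
  seqs-unique n zero = [] ∷ []
  seqs-unique n (suc k) rewrite prefixing≡cartesianProduct (upTo n) (seqs n k) =
    cartesianProductWith⁺ _∷_ ∷-injective (upTo⁺ n) (seqs-unique n k)

  T-notIn⁻ : ∀ {x} xs → T (notIn x xs) → ∀ {i} → i < length xs → at xs i ≢ x
  T-notIn⁻ {x} (y ∷ ys) t {zero} _ refl rewrite ≡ᵇ-refl x = t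
  T-notIn⁻ {x} (y ∷ ys) t {suc i} (s≤s i<) = T-notIn⁻ ys (proj₂ (Equivalence.to T-∧ t)) i<

  T-notIn⁺ : ∀ {x} xs → (∀ {i} → i < length xs → at xs i ≢ x) → T (notIn x xs)
  T-notIn⁺ [] _ = _
  T-notIn⁺ {x} (y ∷ ys) y≢ rewrite ≢⇒≡ᵇ-false (λ x≡y → y≢ {0} (s≤s z≤n) (sym x≡y)) =
    T-notIn⁺ ys (λ i< → y≢ (s≤s i<))

  T-distinct⁻ : ∀ w → T (distinct w) → ∀ {i j} → i < length w → j < length w → at w i ≡ at w j → i ≡ j
  T-distinct⁻ (x ∷ xs) t {zero} {zero} _ _ _ = refl
  T-distinct⁻ (x ∷ xs) t {zero} {suc j} _ (s≤s j<) eq = ⊥-elim (T-notIn⁻ xs (proj₁ (Equivalence.to T-∧ t)) j< (sym eq))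
  T-distinct⁻ (x ∷ xs) t {suc i} {zero} (s≤s i<) _ eq = ⊥-elim (T-notIn⁻ xs (proj₁ (Equivalence.to T-∧ t)) i< eq)
  T-distinct⁻ (x ∷ xs) t {suc i} {suc j} (s≤s i<) (s≤s j<) eq =
    cong suc (T-distinct⁻ xs (proj₂ (Equivalence.to T-∧ t)) i< j< eq)

  T-distinct⁺ : ∀ w → (∀ {i j} → i < length w → j < length w → at w i ≡ at w j → i ≡ j) → T (distinct w)
  T-distinct⁺ [] _ = _
  T-distinct⁺ (x ∷ xs) inj = Equivalence.from T-∧
    ( T-notIn⁺ xs (λ i< eq → 0≢1+n (inj (s≤s z≤n) (s≤s i<) (sym eq)))
    , T-distinct⁺ xs (λ i< j< eq → suc-injective (inj (s≤s i<) (s≤s j<) eq)))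

  SymGroup-unique : ∀ n → Unique (SymGroup n)
  SymGroup-unique n = filter⁺ (λ w → T? (distinct w)) (seqs-unique n n)

  AltGroup-unique : ∀ n → Unique (AltGroup n)
  AltGroup-unique n = filter⁺ (λ w → T? (isEven (inversions w))) (SymGroup-unique n)

  -- In the step for suc n, redirecting the value n to f n gives an injective self-map of {0, …, n ∸ 1}.
  injective⇒surjective : ∀ n (f : ℕ → ℕ) → (∀ {x} → x < n → f x < n) →
                         (∀ {x y} → x < n → y < n → f x ≡ f y → x ≡ y) →
                         ∀ {y} → y < n → Σ ℕ λ x → x < n × f x ≡ y
  injective⇒surjective (suc n) f f< f-inj {y} y<1+n = onto
    where
    g : ℕ → ℕ
    g x with f x ≟ n
    ... | yes _ = f n
    ... | no _ = f x

    g-spec : ∀ x → (f x ≡ n × g x ≡ f n) ⊎ (f x ≢ n × g x ≡ f x)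
    g-spec x with f x ≟ n
    ... | yes fx≡n = inj₁ (fx≡n , refl)
    ... | no fx≢n = inj₂ (fx≢n , refl)

    lift : ∀ {x} → x < n → x < suc n
    lift = m≤n⇒m≤1+n

    fx≢fn : ∀ {x} → x < n → f x ≢ f n
    fx≢fn x<n eq = <-irrefl (f-inj (lift x<n) ≤-refl eq) x<n

    g< : ∀ {x} → x < n → g x < n
    g< {x} x<n with g-spec x
    ... | inj₁ (fx≡n , gx≡fn) rewrite gx≡fn =
      ≤∧≢⇒< (≤-pred (f< ≤-refl)) (λ fn≡n → fx≢fn x<n (trans fx≡n (sym fn≡n)))
    ... | inj₂ (fx≢n , gx≡fx) rewrite gx≡fx = ≤∧≢⇒< (≤-pred (f< (lift x<n))) fx≢n

    g-inj : ∀ {x y} → x < n → y < n → g x ≡ g y → x ≡ y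
    g-inj {x} {y} x<n y<n eq with g-spec x | g-spec y
    ... | inj₁ (fx≡n , _) | inj₁ (fy≡n , _) = f-inj (lift x<n) (lift y<n) (trans fx≡n (sym fy≡n))
    ... | inj₁ (_ , gx≡fn) | inj₂ (_ , gy≡fy) = ⊥-elim (fx≢fn y<n (trans (sym gy≡fy) (trans (sym eq) gx≡fn)))
    ... | inj₂ (_ , gx≡fx) | inj₁ (_ , gy≡fn) = ⊥-elim (fx≢fn x<n (trans (sym gx≡fx) (trans eq gy≡fn)))
    ... | inj₂ (_ , gx≡fx) | inj₂ (_ , gy≡fy) = f-inj (lift x<n) (lift y<n) (trans (sym gx≡fx) (trans eq gy≡fy))

    onto : Σ ℕ λ x → x < suc n × f x ≡ y
    onto with y ≟ f n
    ... | yes refl = n , ≤-refl , refl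
    ... | no y≢fn with y ≟ n
    ...   | yes refl
      with injective⇒surjective n g g< g-inj {f n} (≤∧≢⇒< (≤-pred (f< ≤-refl)) (λ fn≡n → y≢fn (sym fn≡n)))
    ...     | x , x<n , gx≡fn with g-spec x
    ...       | inj₁ (fx≡n , _) = x , lift x<n , fx≡n
    ...       | inj₂ (_ , gx≡fx) = ⊥-elim (fx≢fn x<n (trans (sym gx≡fx) gx≡fn))
    onto | no y≢fn | no y≢n with injective⇒surjective n g g< g-inj (≤∧≢⇒< (≤-pred y<1+n) y≢n)
    ...     | x , x<n , gx≡y with g-spec x
    ...       | inj₁ (_ , gx≡fn) = ⊥-elim (y≢fn (trans (sym gx≡y) gx≡fn))
    ...       | inj₂ (_ , gx≡fx) = x , lift x<n , trans (sym gx≡fx) gx≡y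

  fromOneLine : ℕ → List ℕ → ℕ → ℕ
  fromOneLine N w x = if x <ᵇ N then at w x else x

  fromOneLine-< : ∀ {N} w {x} → x < N → fromOneLine N w x ≡ at w x
  fromOneLine-< w x<N rewrite <ᵇ-true x<N = refl

  fromOneLine-≥ : ∀ {N} w {x} → ¬ x < N → fromOneLine N w x ≡ x
  fromOneLine-≥ w x≮N rewrite <ᵇ-false x≮N = refl

  oneLine∈SymGroup : ∀ {T V} → PermutationOn T V → oneLine (suc T) V ∈ SymGroup (suc T)
  oneLine∈SymGroup {T} {V} π = ∈-filter⁺ (λ w → T? (distinct w))
    (∈-seqs⁺ (length-oneLine (suc T) V) (All.tabulate below))
    (T-distinct⁺ _ λ i< j< eq → injective π _ _
      (trans (sym (at-oneLine V (ℓ i<))) (trans eq (at-oneLine V (ℓ j<)))))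
    where
    ℓ : ∀ {i} → i < length (oneLine (suc T) V) → i < suc T
    ℓ {i} = subst (i <_) (length-oneLine (suc T) V)
    below : ∀ {y} → y ∈ oneLine (suc T) V → y < suc T
    below y∈ with ∈-map⁻ V y∈
    ... | x , x∈ , refl = s≤s (PermutationOn-≤ π (≤-pred (∈-upTo⁻ x∈)))

  ∈SymGroup⇒ : ∀ {T w} → w ∈ SymGroup (suc T) →
               PermutationOn T (fromOneLine (suc T) w) × w ≡ oneLine (suc T) (fromOneLine (suc T) w)
  ∈SymGroup⇒ {T} {w} w∈ with ∈-filter⁻ (λ w → T? (distinct w)) {xs = seqs (suc T) (suc T)} w∈
  ... | w∈seqs , w-distinct with ∈-seqs⁻ (suc T) (suc T) w∈seqs
  ... | len≡ , w< = π , w≡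
    where
    N = suc T
    V = fromOneLine N w
    ℓ : ∀ {i} → i < N → i < length w
    ℓ {i} = subst (i <_) (sym len≡)
    at< : ∀ {i} → i < N → at w i < N
    at< i<N = All.lookup w< (at∈ w (ℓ i<N))
    at-inj : ∀ {i j} → i < N → j < N → at w i ≡ at w j → i ≡ j
    at-inj i<N j<N = T-distinct⁻ w w-distinct (ℓ i<N) (ℓ j<N)
    V≡at : ∀ {x} → x < N → V x ≡ at w x
    V≡at = fromOneLine-< w
    π : PermutationOn T V
    π = record
      { fixes-above = λ x T<x → fromOneLine-≥ w (<⇒≱ T<x ∘′ ≤-pred)
      ; injective = inj
      ; surjective = λ y y≤T → let (x , x<N , eq) = injective⇒surjective N (at w) at< at-inj (s≤s y≤T)
                               in x , ≤-pred x<N , trans (V≡at x<N) eq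
      }
      where
      inj : ∀ x y → V x ≡ V y → x ≡ y
      inj x y eq with x <? N | y <? N
      ... | yes x<N | yes y<N = at-inj x<N y<N (trans (sym (V≡at x<N)) (trans eq (V≡at y<N)))
      ... | yes x<N | no y≮N =
        ⊥-elim (y≮N (subst (_< N) (trans (sym (V≡at x<N)) (trans eq (fromOneLine-≥ w y≮N))) (at< x<N)))
      ... | no x≮N | yes y<N =
        ⊥-elim (x≮N (subst (_< N) (trans (sym (V≡at y<N)) (trans (sym eq) (fromOneLine-≥ w x≮N))) (at< y<N)))
      ... | no x≮N | no y≮N = trans (sym (fromOneLine-≥ w x≮N)) (trans eq (fromOneLine-≥ w y≮N))
    w≡ : w ≡ oneLine N V
    w≡ = at-extensionality w (oneLine N V) (trans len≡ (sym (length-oneLine N V)))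
      λ i i< → let i<N = subst (i <_) len≡ i< in trans (sym (V≡at i<N)) (sym (at-oneLine V i<N))

  oneLine∈AltGroup : ∀ {T V} → PermutationOn T V → sign T V ≡ true → oneLine (suc T) V ∈ AltGroup (suc T)
  oneLine∈AltGroup π even = ∈-filter⁺ (λ w → T? (isEven (inversions w))) (oneLine∈SymGroup π)
    (Equivalence.from T-≡ even)

  ∈AltGroup⇒ : ∀ {T w} → w ∈ AltGroup (suc T) →
               PermutationOn T (fromOneLine (suc T) w) × sign T (fromOneLine (suc T) w) ≡ true ×
               w ≡ oneLine (suc T) (fromOneLine (suc T) w)
  ∈AltGroup⇒ {T} w∈ with ∈-filter⁻ (λ w → T? (isEven (inversions w))) {xs = SymGroup (suc T)} w∈
  ... | w∈S , even with ∈SymGroup⇒ w∈S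
  ... | π , w≡ = π , trans (cong (λ l → isEven (inversions l)) (sym w≡)) (Equivalence.to T-≡ even) , w≡

  -- The transversals of S_{m+1} and A_{m+2}

  zipWith-pointwise : ∀ {P : List ℕ → List ℕ → Set} (E R : ℕ → ℕ → List ℕ) {bl} →
                      All (λ j → ∀ k → P (E j k) (R j k)) bl → ∀ c → Pointwise P (zipWith E bl c) (zipWith R bl c)
  zipWith-pointwise E R [] _ = []
  zipWith-pointwise E R (Pj ∷ Pbl) [] = []
  zipWith-pointwise E R (Pj ∷ Pbl) (k ∷ c) = Pj k ∷ zipWith-pointwise E R Pbl c

  desc-≤ : ∀ j k → All (_≤ j) (desc j k)
  desc-≤ j zero = []
  desc-≤ j (suc k) = ≤-refl ∷ All.map (λ i≤ → ≤-trans i≤ (m∸n≤m j 1)) (desc-≤ (j ∸ 1) k)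

  ⟦desc⟧ : ∀ {j k} → k ≤ j → ⟦ desc j k ⟧ (j ∸ k) ≡ j
  ⟦desc⟧ {j} {zero} _ = refl
  ⟦desc⟧ {suc j} {suc k} (s≤s k≤j) = trans (cong (transposition (suc j)) (⟦desc⟧ k≤j)) (transposition-left j)

  elemS-spells : ∀ {m j} k → j ≤ m → Spells m (elemS (suc m) j k) (desc j k)
  elemS-spells {m} {j} k j≤m = subst (Spells m _) (concat-map-[ desc j k ])
    (prodL-spells (transpositions (desc j k) (All.map (λ i≤ → ≤-trans i≤ j≤m) (desc-≤ j k))))
    where
    transpositions : ∀ l → All (_≤ m) l → Pointwise (Spells m) (map (sS (suc m)) l) (map (_∷ []) l)
    transpositions [] [] = []
    transpositions (i ∷ l) (i≤ ∷ l≤) = spells-transposition i≤ ∷ transpositions l l≤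

  symmetricTransversal : Transversal 0
  symmetricTransversal = record
    { bound = λ j → j
    ; rep = desc
    ; origin = _∸_
    ; rep-≤ = λ {j} {k} _ _ → desc-≤ j k
    ; rep-origin = λ _ k≤j → ⟦desc⟧ k≤j
    ; origin-injective = ∸-cancelˡ-≡
    ; origin-surjective = λ {j} {p} _ p≤j → j ∸ p , m∸n≤m j p , m∸[m∸n]≡n p≤j
    }

  symmetricGroups : Compatible symmetricTransversal
  symmetricGroups = record
    { Member = λ _ _ → ⊤
    ; Member-cong = λ _ _ → tt
    ; Member-trivial = trivial
    ; Member-id = tt
    ; Member-∘rep = λ _ _ _ _ → tt
    ; Member-∘rep⁻¹ = λ _ _ _ _ → tt
    ; Member-restrict = λ _ _ _ → tt
    ; Member-extend = λ _ _ → tt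
    }
    where
    trivial : ∀ {V} → PermutationOn 0 V → ⊤ → ∀ x → V x ≡ x
    trivial π _ zero with surjective π 0 z≤n
    ... | zero , _ , V0≡0 = V0≡0
    trivial π _ (suc x) = fixes-above π (suc x) (s≤s z≤n)

  aWord : ℕ → List ℕ
  aWord i = 1 ∷ suc i ∷ []

  a₁⁻¹Word : List ℕ
  a₁⁻¹Word = 2 ∷ 1 ∷ []

  aWords : ℕ → ℕ → List ℕ
  aWords j k = concat (map aWord (desc j k))

  alternatingRep : ℕ → ℕ → List ℕ
  alternatingRep j k = if k <ᵇ suc j then aWords j k else aWords j (j ∸ 1) ++ a₁⁻¹Word

  aA-spells : ∀ {T i} → i < T → Spells T (aA (suc T) i) (aWord i)
  aA-spells i<T = comp-spells (spells-transposition (≤-trans (s≤s z≤n) i<T)) (spells-transposition i<T)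

  aInv1-spells : ∀ {T} → 2 ≤ T → Spells T (aInv1 (suc T)) a₁⁻¹Word
  aInv1-spells 2≤T = comp-spells (spells-transposition 2≤T) (spells-transposition (≤-trans (s≤s z≤n) 2≤T))

  aWords-pointwise : ∀ {T} l → All (_< T) l → Pointwise (Spells T) (map (aA (suc T)) l) (map aWord l)
  aWords-pointwise [] [] = []
  aWords-pointwise (i ∷ l) (i< ∷ l<) = aA-spells i< ∷ aWords-pointwise l l<

  elemA-spells : ∀ {m j} k → 1 ≤ j → j ≤ m → Spells (suc m) (elemA (suc (suc m)) j k) (alternatingRep j k)
  elemA-spells {m} {j} k 1≤j j≤m with k <ᵇ suc j
  ... | true = prodL-spells (aWords-pointwise (desc j k) (desc< k))
    where
    desc< : ∀ k → All (_< suc m) (desc j k)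
    desc< k = All.map (λ i≤ → s≤s (≤-trans i≤ j≤m)) (desc-≤ j k)
  ... | false = subst (Spells (suc m) _) concat≡
    (prodL-spells (Pointwise.++⁺ (aWords-pointwise (desc j (j ∸ 1))
       (All.map (λ i≤ → s≤s (≤-trans i≤ j≤m)) (desc-≤ j (j ∸ 1)))) (aInv1-spells (s≤s (≤-trans 1≤j j≤m)) ∷ [])))
    where
    concat≡ : concat (map aWord (desc j (j ∸ 1)) ++ a₁⁻¹Word ∷ []) ≡ aWords j (j ∸ 1) ++ a₁⁻¹Word
    concat≡ = trans (sym (concat-++ (map aWord (desc j (j ∸ 1))) (a₁⁻¹Word ∷ [])))
                    (cong (aWords j (j ∸ 1) ++_) (++-identityʳ a₁⁻¹Word))

  aWords-letters : ∀ {j} k → All (Letter (suc j)) (aWords j k)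
  aWords-letters {j} k = go (desc j k) (desc-≤ j k)
    where
    go : ∀ l → All (_≤ j) l → All (Letter (suc j)) (concat (map aWord l))
    go [] [] = []
    go (i ∷ l) (i≤ ∷ l≤) = (s≤s z≤n , s≤s z≤n) ∷ (s≤s z≤n , s≤s i≤) ∷ go l l≤

  alternatingRep-letters : ∀ {j} k → 1 ≤ j → All (Letter (suc j)) (alternatingRep j k)
  alternatingRep-letters {j} k 1≤j with k <ᵇ suc j
  ... | true = aWords-letters k
  ... | false = ++⁺ (aWords-letters (j ∸ 1))
                  ((s≤s z≤n , s≤s 1≤j) ∷ (s≤s z≤n , s≤s z≤n) ∷ [])

  aWords-even : ∀ j k → Even (length (aWords j k))
  aWords-even j k = go (desc j k)
    where
    go : ∀ l → Even (length (concat (map aWord l)))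
    go [] = even-zero
    go (i ∷ l) = even-2+ (go l)

  alternatingRep-even : ∀ j k → Even (length (alternatingRep j k))
  alternatingRep-even j k with k <ᵇ suc j
  ... | true = aWords-even j k
  ... | false = subst Even (sym (length-++ (aWords j (j ∸ 1)))) (Even-+ (aWords-even j (j ∸ 1)) (even-2+ even-zero))

  ⟦aWords⟧ : ∀ {j k} → k ≤ j → ⟦ aWords j k ⟧ (suc j ∸ k) ≡ suc j
  ⟦aWords⟧ {j} {zero} _ = refl
  ⟦aWords⟧ {suc j} {suc k} (s≤s k≤j) = begin
    transposition 1 (transposition (suc (suc j)) (⟦ aWords j k ⟧ (suc j ∸ k)))
      ≡⟨ cong (λ x → transposition 1 (transposition (suc (suc j)) x)) (⟦aWords⟧ k≤j) ⟩
    transposition 1 (transposition (suc (suc j)) (suc j))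
      ≡⟨ cong (transposition 1) (transposition-left (suc j)) ⟩
    transposition 1 (suc (suc j))
      ≡⟨ transposition-fixes-above 1 (suc (suc j)) (s≤s (s≤s z≤n)) ⟩
    suc (suc j) ∎
    where open ≡-Reasoning

  ⟦alternatingRep⟧ : ∀ {j k} → 1 ≤ j → k ≤ suc j → ⟦ alternatingRep j k ⟧ (suc j ∸ k) ≡ suc j
  ⟦alternatingRep⟧ {j} {k} 1≤j k≤1+j with k <ᵇ suc j in eq
  ... | true = ⟦aWords⟧ (≤-pred (<ᵇ⇒< k (suc j) (subst T (sym eq) _)))
  ... | false rewrite ≤-antisym k≤1+j (≮⇒≥ (λ k<1+j → subst T eq (<⇒<ᵇ k<1+j))) | n∸n≡0 (suc j) = last j 1≤j
    where
    last : ∀ j → 1 ≤ j → ⟦ aWords j (j ∸ 1) ++ a₁⁻¹Word ⟧ 0 ≡ suc j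
    last (suc j) _ = begin
      ⟦ aWords (suc j) j ++ a₁⁻¹Word ⟧ 0  ≡⟨ ⟦++⟧ (aWords (suc j) j) a₁⁻¹Word 0 ⟩
      ⟦ aWords (suc j) j ⟧ 2              ≡⟨ cong ⟦ aWords (suc j) j ⟧ (sym (m+n∸n≡m 2 j)) ⟩
      ⟦ aWords (suc j) j ⟧ (2 + j ∸ j)    ≡⟨ ⟦aWords⟧ (n≤1+n j) ⟩
      suc (suc j) ∎
      where open ≡-Reasoning

  alternatingTransversal : Transversal 1
  alternatingTransversal = record
    { bound = suc
    ; rep = alternatingRep
    ; origin = λ j k → suc j ∸ k
    ; rep-≤ = λ {j} {k} 1≤j _ → All.map proj₂ (alternatingRep-letters k 1≤j)
    ; rep-origin = ⟦alternatingRep⟧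
    ; origin-injective = ∸-cancelˡ-≡
    ; origin-surjective = λ {j} {p} _ p≤1+j → suc j ∸ p , m∸n≤m (suc j) p , m∸[m∸n]≡n p≤1+j
    }

  alternatingGroups : Compatible alternatingTransversal
  alternatingGroups = record
    { Member = λ T V → sign T V ≡ true
    ; Member-cong = λ {T} V≗V′ even → trans (sym (sign-cong T V≗V′)) even
    ; Member-trivial = sign-trivial
    ; Member-id = refl
    ; Member-∘rep = λ {j} {k} 1≤j _ π even →
        trans (sign-∘⟦⟧ _ (alternatingRep-even j k) (alternatingRep-letters k 1≤j) π) even
    ; Member-∘rep⁻¹ = λ {j} {k} 1≤j _ π even →
        trans (sign-∘⟦⟧ _ (subst Even (sym (length-reverse (alternatingRep j k))) (alternatingRep-even j k))
                          (All-reverse (alternatingRep-letters k 1≤j)) π) even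
    ; Member-restrict = λ π top even → trans (sym (sign-extend (PermutationOn-restrict π top) top)) even
    ; Member-extend = λ π even → trans (sign-extend π (fixes-above π _ (n<1+n _))) even
    }

  map-unique : ∀ {A B : Set} (p : A → B) {xs} → Unique xs →
               (∀ {x y} → x ∈ xs → y ∈ xs → p x ≡ p y → x ≡ y) → Unique (map p xs)
  map-unique p [] _ = []
  map-unique p {x ∷ xs} (x∉xs ∷ xs!) p-inj =
    images-differ x∉xs (λ y∈ → y∈) ∷ map-unique p xs! (λ x∈ y∈ → p-inj (there x∈) (there y∈))
    where
    images-differ : ∀ {ys} → All (x ≢_) ys → (∀ {y} → y ∈ ys → y ∈ xs) → All (p x ≢_) (map p ys)
    images-differ [] _ = []
    images-differ (x≢y ∷ x≢ys) ⊆xs = (λ eq → x≢y (p-inj (here refl) (there (⊆xs (here refl))) eq))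
                                 ∷ images-differ x≢ys (λ y∈ → ⊆xs (there y∈))

  map-↭ : ∀ {A B : Set} (p : A → B) {xs ys} → Unique xs → Unique ys →
          (∀ {x y} → x ∈ xs → y ∈ xs → p x ≡ p y → x ≡ y) →
          (∀ {x} → x ∈ xs → p x ∈ ys) → (∀ {y} → y ∈ ys → Σ A λ x → x ∈ xs × p x ≡ y) → map p xs ↭ ys
  map-↭ p xs! ys! p-inj into onto = ∼bag⇒↭ (unique∧set⇒bag (map-unique p xs! p-inj) ys! (mk⇔ to from))
    where
    to : ∀ {y} → y ∈ map p _ → y ∈ _
    to y∈ with ∈-map⁻ p y∈
    ... | x , x∈ , refl = into x∈
    from : ∀ {y} → y ∈ _ → y ∈ map p _
    from y∈ with onto y∈
    ... | x , x∈ , refl = ∈-map⁺ p x∈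

  module Sym = Factorisation symmetricTransversal symmetricGroups
  module Alt = Factorisation alternatingTransversal alternatingGroups

  productS-oneLine : ∀ m c → productS (suc m) c ≡ oneLine (suc m) (Sym.product m c)
  productS-oneLine m c = proj₂ (prodL-spells (zipWith-pointwise (elemS (suc m)) desc
    (All.map (λ (_ , j≤m) k → elemS-spells k j≤m) (All-levels m)) c))

  productA-oneLine : ∀ m c → productA (suc m) c ≡ oneLine (suc (suc m)) (Alt.product m c)
  productA-oneLine m c = proj₂ (prodL-spells (zipWith-pointwise (elemA (suc (suc m))) alternatingRep
    (All.map (λ (1≤j , j≤m) k → elemA-spells k 1≤j j≤m) (All-levels m)) c))

  tuplesS⇒Choice : ∀ {m c} → c ∈ tuplesS (suc m) → Sym.Choice m c
  tuplesS⇒Choice {m} c∈ = subst (Pointwise _≤_ _) (sym (map-id (levels m))) (∈-choices⁻ (levels m) c∈)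

  Choice⇒tuplesS : ∀ {m c} → Sym.Choice m c → c ∈ tuplesS (suc m)
  Choice⇒tuplesS {m} c≤ = ∈-choices⁺ (subst (Pointwise _≤_ _) (map-id (levels m)) c≤)

  productS-injective : ∀ {m c d} → Sym.Choice m c → Sym.Choice m d → productS (suc m) c ≡ productS (suc m) d → c ≡ d
  productS-injective {m} {c} {d} c≤ d≤ eq = Sym.product-injective c≤ d≤
    (oneLine-injective (Sym.product-permutationOn c≤) (Sym.product-permutationOn d≤)
      (trans (sym (productS-oneLine m c)) (trans eq (productS-oneLine m d))))

  productA-injective : ∀ {m c d} → Alt.Choice m c → Alt.Choice m d → productA (suc m) c ≡ productA (suc m) d → c ≡ d
  productA-injective {m} {c} {d} c≤ d≤ eq = Alt.product-injective c≤ d≤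
    (oneLine-injective (Alt.product-permutationOn c≤) (Alt.product-permutationOn d≤)
      (trans (sym (productA-oneLine m c)) (trans eq (productA-oneLine m d))))

  productS∈SymGroup : ∀ {m c} → Sym.Choice m c → productS (suc m) c ∈ SymGroup (suc m)
  productS∈SymGroup {m} {c} c≤ =
    subst (_∈ SymGroup (suc m)) (sym (productS-oneLine m c)) (oneLine∈SymGroup (Sym.product-permutationOn c≤))

  productA∈AltGroup : ∀ {m c} → Alt.Choice m c → productA (suc m) c ∈ AltGroup (suc (suc m))
  productA∈AltGroup {m} {c} c≤ = subst (_∈ AltGroup (suc (suc m))) (sym (productA-oneLine m c))
    (oneLine∈AltGroup (Alt.product-permutationOn c≤) (Alt.product-member c≤))

  SymGroup⊆productS : ∀ {m w} → w ∈ SymGroup (suc m) → Σ (List ℕ) λ c → Sym.Choice m c × productS (suc m) c ≡ w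
  SymGroup⊆productS {m} w∈ with ∈SymGroup⇒ w∈
  ... | π , w≡ with Sym.product-surjective π _
  ... | c , c≤ , c≗ = c , c≤ , trans (productS-oneLine m c) (trans (oneLine-cong (suc m) c≗) (sym w≡))

  AltGroup⊆productA : ∀ {m w} → w ∈ AltGroup (suc (suc m)) → Σ (List ℕ) λ c → Alt.Choice m c × productA (suc m) c ≡ w
  AltGroup⊆productA {m} w∈ with ∈AltGroup⇒ w∈
  ... | π , even , w≡ with Alt.product-surjective π even
  ... | c , c≤ , c≗ = c , c≤ , trans (productA-oneLine m c) (trans (oneLine-cong (suc (suc m)) c≗) (sym w≡))

  productS-enumerates : ∀ m → map (productS (suc m)) (tuplesS (suc m)) ↭ SymGroup (suc m)
  productS-enumerates m = map-↭ (productS (suc m)) (choices-unique (levels m)) (SymGroup-unique (suc m))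
    (λ c∈ d∈ → productS-injective {m} (tuplesS⇒Choice c∈) (tuplesS⇒Choice d∈))
    (λ c∈ → productS∈SymGroup {m} (tuplesS⇒Choice c∈))
    (λ w∈ → let (c , c≤ , eq) = SymGroup⊆productS {m} w∈ in c , Choice⇒tuplesS c≤ , eq)

  productA-enumerates : ∀ m → map (productA (suc m)) (tuplesA (suc m)) ↭ AltGroup (suc (suc m))
  productA-enumerates m = map-↭ (productA (suc m)) (choices-unique (map suc (levels m))) (AltGroup-unique (suc (suc m)))
    (λ c∈ d∈ → productA-injective {m} (∈-choices⁻ _ c∈) (∈-choices⁻ _ d∈))
    (λ c∈ → productA∈AltGroup {m} (∈-choices⁻ _ c∈))
    (λ w∈ → let (c , c≤ , eq) = AltGroup⊆productA {m} w∈ in c , ∈-choices⁺ c≤ , eq)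

  findFirst-unique : ∀ (p : List ℕ → Bool) {xs c} → c ∈ xs → p c ≡ true →
                     (∀ {c′} → c′ ∈ xs → p c′ ≡ true → c′ ≡ c) → findFirst p xs ≡ c
  findFirst-unique p {x ∷ xs} c∈ pc only with p x in px
  ... | true = only (here refl) px
  findFirst-unique p {x ∷ xs} (here refl) pc only | false = ⊥-elim (false≢true (trans (sym px) pc))
    where
    false≢true : false ≢ true
    false≢true ()
  findFirst-unique p {x ∷ xs} (there c∈) pc only | false = findFirst-unique p c∈ pc (λ c′∈ → only (there c′∈))

  eqL-refl : ∀ x → eqL x x ≡ true
  eqL-refl [] = refl
  eqL-refl (a ∷ x) rewrite ≡ᵇ-refl a = eqL-refl x

  eqL⇒≡ : ∀ x y → eqL x y ≡ true → x ≡ y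
  eqL⇒≡ [] [] _ = refl
  eqL⇒≡ (a ∷ x) (b ∷ y) eq with a ≡ᵇ b in a≡ᵇb
  ... | true = cong₂ _∷_ (≡ᵇ⇒≡ a b (subst T (sym a≡ᵇb) _)) (eqL⇒≡ x y eq)

  factorS-productS : ∀ {m c} → Sym.Choice m c → factorS (suc m) (productS (suc m) c) ≡ c
  factorS-productS {m} {c} c≤ = findFirst-unique _ (Choice⇒tuplesS c≤) (eqL-refl (productS (suc m) c))
    (λ c′∈ eq → productS-injective (tuplesS⇒Choice c′∈) c≤ (eqL⇒≡ _ _ eq))

  factorA-productA : ∀ {m c} → Alt.Choice m c → factorA (suc m) (productA (suc m) c) ≡ c
  factorA-productA {m} {c} c≤ = findFirst-unique _ (∈-choices⁺ c≤) (eqL-refl (productA (suc m) c))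
    (λ c′∈ eq → productA-injective {m} (∈-choices⁻ _ c′∈) c≤ (eqL⇒≡ _ _ eq))

  clamp : ℕ → ℕ → ℕ
  clamp j k = if k <ᵇ j then k else j

  indicator : ℕ → ℕ → ℕ
  indicator j x = if x ≡ᵇ j then 1 else 0

  clamp-< : ∀ {j k} → k < j → clamp j k ≡ k
  clamp-< k<j rewrite <ᵇ-true k<j = refl

  clamp-≮ : ∀ {j k} → ¬ k < j → clamp j k ≡ j
  clamp-≮ k≮j rewrite <ᵇ-false k≮j = refl

  fElem-clamp : ∀ n j k → fElem n j k ≡ elemS n j (clamp j k)
  fElem-clamp n j k with k <ᵇ j
  ... | true = refl
  ... | false = refl

  epsA-clamp : ∀ j x → (if x <ᵇ j then 0 else 1) ≡ indicator j (clamp j x)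
  epsA-clamp j x with x <ᵇ j in x<ᵇj
  ... | true rewrite ≢⇒≡ᵇ-false (<⇒≢ (<ᵇ⇒< x j (subst T (sym x<ᵇj) _))) = refl
  ... | false rewrite ≡ᵇ-refl j = refl

  zipWith-zipWith : ∀ {a} {X : Set a} (f : ℕ → ℕ → X) (g : ℕ → ℕ → ℕ) bl c →
                    zipWith f bl (zipWith g bl c) ≡ zipWith (λ j x → f j (g j x)) bl c
  zipWith-zipWith f g [] c = refl
  zipWith-zipWith f g (j ∷ bl) [] = refl
  zipWith-zipWith f g (j ∷ bl) (x ∷ c) = cong (f j (g j x) ∷_) (zipWith-zipWith f g bl c)

  -- the factor of level j sits at position j ∸ 1 of the choice list
  map-at≡zipWith : ∀ {a} {X : Set a} (P : ℕ → ℕ → X) m c → length c ≡ m →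
                   map (λ j → P j (at c (j ∸ 1))) (levels m) ≡ zipWith P (levels m) c
  map-at≡zipWith P m c len≡ = begin
    map (λ j → P j (at c (j ∸ 1))) (map suc (upTo m)) ≡⟨ sym (map-∘ (upTo m)) ⟩
    map (λ i → P (suc i) (at c i)) (upTo m)          ≡⟨ map-upTo _ m ⟩
    applyUpTo (λ i → P (suc i) (at c i)) m           ≡⟨ applyUpTo≡zipWith m suc c len≡ ⟩
    zipWith P (applyUpTo suc m) c                    ≡⟨ cong (λ l → zipWith P l c) (sym (map-upTo suc m)) ⟩
    zipWith P (map suc (upTo m)) c ∎
    where
    open ≡-Reasoning
    applyUpTo≡zipWith : ∀ m (g : ℕ → ℕ) c → length c ≡ m →
                        applyUpTo (λ i → P (g i) (at c i)) m ≡ zipWith P (applyUpTo g m) c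
    applyUpTo≡zipWith zero g [] _ = refl
    applyUpTo≡zipWith (suc m) g (x ∷ c) eq = cong (P (g 0) x ∷_) (applyUpTo≡zipWith m (λ i → g (suc i)) c (suc-injective eq))

  Choice-length : ∀ {f : ℕ → ℕ} {m c} → Pointwise _≤_ c (map f (levels m)) → length c ≡ m
  Choice-length {f} {m} c≤ = trans (Pointwise-length c≤) (trans (length-map f (levels m)) (length-levels m))

  fMap-productA : ∀ {m c} → Alt.Choice m c → fMap (suc m) (productA (suc m) c) ≡ productS (suc m) (zipWith clamp (levels m) c)
  fMap-productA {m} {c} c≤ rewrite factorA-productA c≤ = cong (prodL (suc m)) (begin
    zipWith (fElem (suc m)) (levels m) c                     ≡⟨ zipWith-cong (fElem-clamp (suc m)) (levels m) c ⟩
    zipWith (λ j k → elemS (suc m) j (clamp j k)) (levels m) c ≡⟨ sym (zipWith-zipWith (elemS (suc m)) clamp (levels m) c) ⟩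
    zipWith (elemS (suc m)) (levels m) (zipWith clamp (levels m) c) ∎)
    where open ≡-Reasoning

  epsA-productA : ∀ {a} {X : Set a} (f : ℕ → ℕ → X) {m c} → Alt.Choice m c →
                  map (λ j → f j (epsA (suc m) j (productA (suc m) c))) (levels m) ≡
                  zipWith (λ j x → f j (indicator j x)) (levels m) (zipWith clamp (levels m) c)
  epsA-productA f {m} {c} c≤ rewrite factorA-productA c≤ = begin
    map (λ j → f j (if at c (j ∸ 1) <ᵇ j then 0 else 1)) (levels m)
      ≡⟨ map-at≡zipWith (λ j x → f j (if x <ᵇ j then 0 else 1)) m c (Choice-length c≤) ⟩
    zipWith (λ j x → f j (if x <ᵇ j then 0 else 1)) (levels m) c
      ≡⟨ zipWith-cong (λ j x → cong (f j) (epsA-clamp j x)) (levels m) c ⟩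
    zipWith (λ j x → f j (indicator j (clamp j x))) (levels m) c
      ≡⟨ sym (zipWith-zipWith (λ j x → f j (indicator j x)) clamp (levels m) c) ⟩
    zipWith (λ j x → f j (indicator j x)) (levels m) (zipWith clamp (levels m) c) ∎
    where open ≡-Reasoning

  epsS-productS : ∀ {a} {X : Set a} (f : ℕ → ℕ → X) {m d} → Sym.Choice m d →
                  map (λ j → f j (epsS (suc m) j (productS (suc m) d))) (levels m) ≡
                  zipWith (λ j x → f j (indicator j x)) (levels m) d
  epsS-productS f {m} {d} d≤ rewrite factorS-productS d≤ =
    map-at≡zipWith (λ j x → f j (indicator j x)) m d (Choice-length d≤)

module GeneratingFunctions {c ℓ} (R : CommutativeSemiring c ℓ) where

  open import Data.Nat using (zero; _<_)
  open import Data.Nat.Properties using (<-irrefl; ≤-trans; n≤1+n; <⇒≢)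
  open import Data.List using (List; []; _∷_; _++_; map; upTo; zipWith; concatMap)
  open import Data.List.Properties using (map-++; map-∘; upTo-∷ʳ)
  open import Data.List.Relation.Unary.Any using (here; there)
  open import Data.List.Membership.Propositional using (_∈_)
  open import Data.List.Membership.Propositional.Properties using (∈-upTo⁻)
  open import Data.List.Relation.Binary.Permutation.Propositional using (_↭_; ↭⇒↭ₛ′)
  import Data.List.Relation.Binary.Permutation.Propositional.Properties as ↭
  open import Relation.Binary.PropositionalEquality as ≡ using (_≡_)
  open Permutations
  open CommutativeSemiring R
  open GF R
  open import Relation.Binary.Reasoning.Setoid setoid
  import Data.List.Relation.Binary.Permutation.Setoid.Properties setoid as Perm
  open import Algebra.Properties.CommutativeSemigroup *-commutativeSemigroup using (interchange; x∙yz≈y∙xz)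
  open import Algebra.Properties.CommutativeSemiring.Exp R using (_^_; ^-distrib-*)

  ≡⇒≈ : ∀ {x y} → x ≡ y → x ≈ y
  ≡⇒≈ ≡.refl = refl

  sumL-↭ : ∀ {A : Set} (g : A → Carrier) {xs ys} → xs ↭ ys → sumL (map g xs) ≈ sumL (map g ys)
  sumL-↭ g xs↭ys = Perm.foldr-commMonoid +-isCommutativeMonoid (↭⇒↭ₛ′ isEquivalence (↭.map⁺ g xs↭ys))

  sumL-cong : ∀ {A : Set} {f g : A → Carrier} xs → (∀ {x} → x ∈ xs → f x ≈ g x) → sumL (map f xs) ≈ sumL (map g xs)
  sumL-cong [] _ = refl
  sumL-cong (x ∷ xs) f≈g = +-cong (f≈g (here ≡.refl)) (sumL-cong xs (λ x∈ → f≈g (there x∈)))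

  sumL-++ : ∀ xs ys → sumL (xs ++ ys) ≈ sumL xs + sumL ys
  sumL-++ [] ys = sym (+-identityˡ _)
  sumL-++ (x ∷ xs) ys = trans (+-cong refl (sumL-++ xs ys)) (sym (+-assoc x _ _))

  sumL-*ˡ : ∀ {A : Set} a (f : A → Carrier) xs → sumL (map (λ x → a * f x) xs) ≈ a * sumL (map f xs)
  sumL-*ˡ a f [] = sym (zeroʳ a)
  sumL-*ˡ a f (x ∷ xs) = trans (+-cong refl (sumL-*ˡ a f xs)) (sym (distribˡ a (f x) _))

  sumL-upTo-suc : ∀ (f : ℕ → Carrier) k → sumL (map f (upTo (suc k))) ≈ sumL (map f (upTo k)) + f k
  sumL-upTo-suc f k = begin
    sumL (map f (upTo (suc k)))         ≡⟨ ≡.cong (λ l → sumL (map f l)) (≡.sym (upTo-∷ʳ k)) ⟩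
    sumL (map f (upTo k ++ k ∷ []))     ≡⟨ ≡.cong sumL (map-++ f (upTo k) (k ∷ [])) ⟩
    sumL (map f (upTo k) ++ f k ∷ [])   ≈⟨ sumL-++ (map f (upTo k)) _ ⟩
    sumL (map f (upTo k)) + (f k + 0#)  ≈⟨ +-cong refl (+-identityʳ _) ⟩
    sumL (map f (upTo k)) + f k ∎

  sumL-choices : ∀ (h : List ℕ → Carrier) k ks →
                 sumL (map h (choices (k ∷ ks))) ≈ sumL (map (λ x → sumL (map (λ c → h (x ∷ c)) (choices ks))) (upTo (suc k)))
  sumL-choices h k ks = go (upTo (suc k))
    where
    go : ∀ xs → sumL (map h (concatMap (λ x → map (x ∷_) (choices ks)) xs)) ≈
                sumL (map (λ x → sumL (map (λ c → h (x ∷ c)) (choices ks))) xs)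
    go [] = refl
    go (x ∷ xs) = begin
      sumL (map h (map (x ∷_) (choices ks) ++ rest))
        ≡⟨ ≡.cong sumL (map-++ h (map (x ∷_) (choices ks)) rest) ⟩
      sumL (map h (map (x ∷_) (choices ks)) ++ map h rest)
        ≈⟨ sumL-++ (map h (map (x ∷_) (choices ks))) _ ⟩
      sumL (map h (map (x ∷_) (choices ks))) + sumL (map h rest)
        ≈⟨ +-cong (≡⇒≈ (≡.cong sumL (≡.sym (map-∘ (choices ks))))) (go xs) ⟩
      sumL (map (λ c → h (x ∷ c)) (choices ks)) + sumL (map (λ x → sumL (map (λ c → h (x ∷ c)) (choices ks))) xs) ∎
      where rest = concatMap (λ x → map (x ∷_) (choices ks)) xs

  pow≡^ : ∀ x k → pow x k ≡ x ^ k
  pow≡^ x zero = ≡.refl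
  pow≡^ x (suc k) = ≡.cong (x *_) (pow≡^ x k)

  pow-distrib-* : ∀ x y k → pow (x * y) k ≈ pow x k * pow y k
  pow-distrib-* x y k rewrite pow≡^ (x * y) k | pow≡^ x k | pow≡^ y k = ^-distrib-* x y k

  prodC-zipWith-pow-* : ∀ a (u : ℕ → Carrier) (e : ℕ → ℕ → ℕ) bl d →
                        prodC (zipWith (λ j x → pow (a * u j) (e j x)) bl d) ≈
                        prodC (zipWith (λ j x → pow a (e j x)) bl d) * prodC (zipWith (λ j x → pow (u j) (e j x)) bl d)
  prodC-zipWith-pow-* a u e [] d = sym (*-identityˡ 1#)
  prodC-zipWith-pow-* a u e (j ∷ bl) [] = sym (*-identityˡ 1#)
  prodC-zipWith-pow-* a u e (j ∷ bl) (x ∷ d) =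
    trans (*-cong (pow-distrib-* a (u j) (e j x)) (prodC-zipWith-pow-* a u e bl d)) (interchange _ _ _ _)

  two : Carrier
  two = 1# + 1#

  -- Choices b and b + 1 at level b are both clamped to b, which therefore counts twice.
  sumL-clamp : ∀ b (A : ℕ → Carrier) →
               sumL (map (λ x → A (clamp b x)) (upTo (suc (suc b)))) ≈
               sumL (map (λ x → pow two (indicator b x) * A x) (upTo (suc b)))
  sumL-clamp b A = begin
    sumL (map (λ x → A (clamp b x)) (upTo (suc (suc b))))
      ≈⟨ trans (sumL-upTo-suc _ (suc b)) (+-cong (sumL-upTo-suc _ b) refl) ⟩
    (sumL (map (λ x → A (clamp b x)) (upTo b)) + A (clamp b b)) + A (clamp b (suc b))
      ≈⟨ +-cong (+-cong (sumL-cong (upTo b) (λ x∈ → ≡⇒≈ (≡.cong A (clamp-< (∈-upTo⁻ x∈)))))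
                        (≡⇒≈ (≡.cong A (clamp-≮ (<-irrefl ≡.refl)))))
                (≡⇒≈ (≡.cong A (clamp-≮ (λ b+1<b → <-irrefl ≡.refl (≤-trans (n≤1+n (suc b)) b+1<b))))) ⟩
    (sumL (map A (upTo b)) + A b) + A b
      ≈⟨ +-assoc _ _ _ ⟩
    sumL (map A (upTo b)) + (A b + A b)
      ≈⟨ +-cong (sumL-cong (upTo b) (λ x∈ → weight-below (∈-upTo⁻ x∈))) (sym weight-top) ⟩
    sumL (map (λ x → pow two (indicator b x) * A x) (upTo b)) + pow two (indicator b b) * A b
      ≈⟨ sym (sumL-upTo-suc _ b) ⟩
    sumL (map (λ x → pow two (indicator b x) * A x) (upTo (suc b))) ∎
    where
    weight-below : ∀ {x} → x < b → A x ≈ pow two (indicator b x) * A x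
    weight-below x<b rewrite ≢⇒≡ᵇ-false (<⇒≢ x<b) = sym (*-identityˡ _)
    weight-top : pow two (indicator b b) * A b ≈ A b + A b
    weight-top rewrite ≡ᵇ-refl b = begin
      (two * 1#) * A b      ≈⟨ *-cong (*-identityʳ two) refl ⟩
      (1# + 1#) * A b       ≈⟨ distribʳ (A b) 1# 1# ⟩
      1# * A b + 1# * A b   ≈⟨ +-cong (*-identityˡ _) (*-identityˡ _) ⟩
      A b + A b ∎

  multiplicity : List ℕ → List ℕ → Carrier
  multiplicity bl d = prodC (zipWith (λ j x → pow two (indicator j x)) bl d)

  sumL-clampAll : ∀ bl (K : List ℕ → Carrier) →
                  sumL (map (λ c → K (zipWith clamp bl c)) (choices (map suc bl))) ≈
                  sumL (map (λ d → multiplicity bl d * K d) (choices bl))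
  sumL-clampAll [] K = +-cong (sym (*-identityˡ _)) refl
  sumL-clampAll (b ∷ bl) K = begin
      sumL (map (λ c → K (zipWith clamp (b ∷ bl) c)) (choices (suc b ∷ map suc bl)))
    ≈⟨ sumL-choices _ (suc b) (map suc bl) ⟩
      sumL (map (λ x → sumL (map (λ c → K (clamp b x ∷ zipWith clamp bl c)) (choices (map suc bl)))) (upTo (suc (suc b))))
    ≈⟨ sumL-cong (upTo (suc (suc b))) (λ {x} _ → sumL-clampAll bl (λ d → K (clamp b x ∷ d))) ⟩
      sumL (map (λ x → A (clamp b x)) (upTo (suc (suc b))))
    ≈⟨ sumL-clamp b A ⟩
      sumL (map (λ y → pow two (indicator b y) * A y) (upTo (suc b)))
    ≈⟨ sumL-cong (upTo (suc b)) (λ {y} _ → sym (level-sum y)) ⟩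
      sumL (map (λ y → sumL (map (λ d → multiplicity (b ∷ bl) (y ∷ d) * K (y ∷ d)) (choices bl))) (upTo (suc b)))
    ≈⟨ sym (sumL-choices (λ d → multiplicity (b ∷ bl) d * K d) b bl) ⟩
      sumL (map (λ d → multiplicity (b ∷ bl) d * K d) (choices (b ∷ bl))) ∎
    where
    A : ℕ → Carrier
    A y = sumL (map (λ d → multiplicity bl d * K (y ∷ d)) (choices bl))
    level-sum : ∀ y → sumL (map (λ d → multiplicity (b ∷ bl) (y ∷ d) * K (y ∷ d)) (choices bl)) ≈
                      pow two (indicator b y) * A y
    level-sum y = trans (sumL-cong (choices bl) (λ _ → *-assoc _ _ _))
                        (sumL-*ˡ (pow two (indicator b y)) (λ d → multiplicity bl d * K (y ∷ d)) (choices bl))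

  sumL-enumeration : ∀ {A : Set} (p : A → List ℕ) (g : List ℕ → Carrier) (h : A → Carrier) {xs ys} →
                     map p xs ↭ ys → (∀ {x} → x ∈ xs → g (p x) ≈ h x) → sumL (map g ys) ≈ sumL (map h xs)
  sumL-enumeration p g h {xs} enum g∘p≈h =
    trans (sym (sumL-↭ g enum)) (trans (≡⇒≈ (≡.cong sumL (≡.sym (map-∘ xs)))) (sumL-cong xs g∘p≈h))

  lhsA≈rhsS : ∀ mS mA → IsFPair mS mA → ∀ m q (t : ℕ → Carrier) → lhsA mA (suc m) q t ≈ rhsS mS (suc m) q t
  lhsA≈rhsS mS mA fpair m q t = begin
    sumL (map termA (AltGroup (suc (suc m))))
      ≈⟨ sumL-enumeration (productA (suc m)) termA _ (productA-enumerates m)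
           (λ c∈ → termA-productA (∈-choices⁻ _ c∈)) ⟩
    sumL (map (λ c → K (zipWith clamp (levels m) c)) (tuplesA (suc m)))
      ≈⟨ sumL-clampAll (levels m) K ⟩
    sumL (map (λ d → multiplicity (levels m) d * K d) (tuplesS (suc m)))
      ≈⟨ sym (sumL-enumeration (productS (suc m)) termS _ (productS-enumerates m)
                (λ d∈ → termS-productS (tuplesS⇒Choice d∈))) ⟩
    sumL (map termS (SymGroup (suc m))) ∎
    where
    termA : List ℕ → Carrier
    termA v = pow q (mA (suc (suc m)) v) * prodC (map (λ j → pow (t j) (epsA (suc m) j v)) (levels m))
    termS : List ℕ → Carrier
    termS w = pow q (mS (suc m) w) * prodC (map (λ j → pow (two * t j) (epsS (suc m) j w)) (levels m))
    tWeights : List ℕ → Carrier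
    tWeights d = prodC (zipWith (λ j x → pow (t j) (indicator j x)) (levels m) d)
    K : List ℕ → Carrier
    K d = pow q (mS (suc m) (productS (suc m) d)) * tWeights d
    termA-productA : ∀ {c} → Alt.Choice m c → termA (productA (suc m) c) ≈ K (zipWith clamp (levels m) c)
    termA-productA c≤ = ≡⇒≈ (≡.cong₂ _*_
      (≡.cong (pow q) (≡.trans (fpair (suc m) (s≤s z≤n) _ (productA∈AltGroup c≤))
                               (≡.cong (mS (suc m)) (fMap-productA c≤))))
      (≡.cong prodC (epsA-productA (λ j e → pow (t j) e) c≤)))
    termS-productS : ∀ {d} → Sym.Choice m d → termS (productS (suc m) d) ≈ multiplicity (levels m) d * K d
    termS-productS {d} d≤ = begin
      Q * prodC (map (λ j → pow (two * t j) (epsS (suc m) j (productS (suc m) d))) (levels m))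
        ≡⟨ ≡.cong (λ l → Q * prodC l) (epsS-productS (λ j e → pow (two * t j) e) d≤) ⟩
      Q * prodC (zipWith (λ j x → pow (two * t j) (indicator j x)) (levels m) d)
        ≈⟨ *-cong refl (prodC-zipWith-pow-* two t indicator (levels m) d) ⟩
      Q * (multiplicity (levels m) d * tWeights d)
        ≈⟨ x∙yz≈y∙xz Q _ _ ⟩
      multiplicity (levels m) d * K d ∎
      where Q = pow q (mS (suc m) (productS (suc m) d))

proposition5p10 : (mS mA : Statistic) → IsFPair mS mA →
    ∀ (n : ℕ) → 2 ≤ n →
    ∀ {c ℓ} (R : CommutativeSemiring c ℓ) (q : CommutativeSemiring.Carrier R)
    (t : ℕ → CommutativeSemiring.Carrier R) →
    CommutativeSemiring._≈_ R (GF.lhsA R mA n q t) (GF.rhsS R mS n q t)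
proposition5p10 mS mA fpair zero ()
proposition5p10 mS mA fpair (suc m) _ R q t = GeneratingFunctions.lhsA≈rhsS R mS mA fpair m q t
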